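{- Let $\alpha=\alpha(n)=O(n)$, let $p=p(n)$ be admissible, and for each $n$ let $t=t_n$ be an $\alpha$-almost supermagic edge labeling of $K_n$. Then $$pn+o(pn)<R(p,t,n)<2pn+o(pn).$$
   Context: $K_n$ is the complete graph on $n$ vertices with edge set $E$, $\epsilon=\binom n2$, $[a]=\{1,\dots,a\}$. For a vertex $v$, $D(v)$ is the set of edges containing $v$. An edge labeling is a bijection $t:E\to[\epsilon]$; $s(t,v)=\sum_{e\in D(v)}t(e)$. $t$ is $\alpha$-almost supermagic if $|s(t,u)-s(t,v)|\le\alpha$ for all vertices $u,v$. A $p$-swap of $t$ is a map $\theta$ sending $t$ to another edge labeling $\theta t$ with $|t(e)-\theta t(e)|\le p$ for all $e$. $R(p,t,n)=\max_{\theta}\max_{u\ne v}|s(\theta t,u)-s(\theta t,v)|$ over all $p$-swaps $\theta$ of $t$. The magnitude $p=p(n)$ is admissible if $p(n)=o(n)$ and $p(n)\to\infty$ as $n\to\infty$. -}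

module Defs where

open import Data.Nat using (ℕ; zero; suc; _+_; _*_; _∸_; _≤_; _<_; ∣_-_∣)
open import Data.Nat.Combinatorics using (_C_)
open import Data.Fin using (Fin; toℕ)
import Data.Fin as F
open import Data.Fin.Properties using (<-cmp)
open import Data.Product using (Σ; ∃; ∃-syntax; _×_; _,_)
open import Function.Bundles using (_⤖_; Bijection)
open import Relation.Binary.Definitions using (tri<; tri≈; tri>)
open import Relation.Nullary using (¬_)
open import Relation.Binary.PropositionalEquality using (_≡_)

-- Edges of K_n on vertex set Fin n: unordered pairs {i,j}, represented as i < j.
Edge : ℕ → Set
Edge n = Σ (Fin n × Fin n) λ { (i , j) → toℕ i < toℕ j }

ε : ℕ → ℕ
ε n = n C 2

-- An edge labeling: a bijection E → [ε], with [ε] = {1,…,ε} encoded as Fin ε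
-- (label of e is 1 + toℕ (to e)).
Labeling : ℕ → Set
Labeling n = Edge n ⤖ Fin (ε n)

label : ∀ {n} → Labeling n → Edge n → ℕ
label t e = suc (toℕ (Bijection.to t e))

-- label of the edge {u,v} (0 if u = v, i.e. no such edge)
pairLabel : ∀ {n} → Labeling n → Fin n → Fin n → ℕ
pairLabel t u v with <-cmp u v
... | tri< u<v _ _ = label t ((u , v) , u<v)
... | tri≈ _ _ _   = 0
... | tri> _ _ v<u = label t ((v , u) , v<u)

sumFin : ∀ n → (Fin n → ℕ) → ℕ
sumFin zero    f = 0
sumFin (suc n) f = f F.zero + sumFin n (λ i → f (F.suc i))

s : ∀ {n} → Labeling n → Fin n → ℕ
s {n} t v = sumFin n (λ u → pairLabel t u v)

AlmostSupermagic : ∀ {n} → ℕ → Labeling n → Set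
AlmostSupermagic {n} α t = ∀ (u v : Fin n) → ∣ s t u - s t v ∣ ≤ α

-- θt is the image of t under a p-swap θ: another labeling with |t(e) − θt(e)| ≤ p
IsPSwapOf : ∀ {n} → ℕ → Labeling n → Labeling n → Set
IsPSwapOf {n} p t t' = ∀ (e : Edge n) → ∣ label t e - label t' e ∣ ≤ p

IsR : ∀ n → ℕ → Labeling n → ℕ → Set
IsR n p t r =
  (∃[ t' ] (IsPSwapOf p t t' × ∃[ u ] ∃[ v ] (¬ u ≡ v × ∣ s t' u - s t' v ∣ ≡ r)))
  × (∀ (t' : Labeling n) → IsPSwapOf p t t' → ∀ (u v : Fin n) → ¬ u ≡ v →
       ∣ s t' u - s t' v ∣ ≤ r)

Eventually : (ℕ → Set) → Set
Eventually P = ∃[ N ] (∀ n → N ≤ n → P n)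

IsBigO-n : (ℕ → ℕ) → Set
IsBigO-n α = ∃[ C ] Eventually (λ n → α n ≤ C * n)

-- p admissible: p(n) = o(n) and p(n) → ∞
Admissible : (ℕ → ℕ) → Set
Admissible p =
  (∀ k → 1 ≤ k → Eventually (λ n → k * p n ≤ n))
  × (∀ M → Eventually (λ n → M ≤ p n))

{-# OPTIONS --safe #-}
module Submission where

open import Defs
open import Data.Bool using (Bool; true; false; _∧_; _∨_; not; T; T?)
open import Data.Bool.Properties using (T-∧; T-∨; T-≡; ∨-comm; ∧-conicalˡ; ∧-conicalʳ; ∧-zeroʳ; ∧-identityʳ; ∧-comm)
open import Data.Empty using (⊥)
open import Data.Fin using (Fin; toℕ; fromℕ<)
import Data.Fin as F
import Data.Fin.Properties as FinP
open import Data.Nat using (ℕ; zero; suc; >-nonZero; _⊔_; _+_; _*_; _∸_; _≤_; _<_; _≤ᵇ_; _<ᵇ_; z≤n; s≤s; ∣_-_∣; _≤?_; _<?_)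
open import Data.Nat.Combinatorics using (_C_; nCk+nC[k+1]≡[n+1]C[k+1]; nC1≡n)
open import Data.Nat.Properties
open import Algebra.Properties.Semiring.Sum +-*-semiring using (sum; sum-syntax; sum-cong-≗; ∑-distrib-+; ∑-comm; *-distribˡ-sum)
open import Data.Nat.Tactic.RingSolver using (solve-∀)
open import Data.Product using (_×_; _,_; proj₁; proj₂; ∃-syntax)
open import Data.Sum using (_⊎_; inj₁; inj₂; [_,_]′)
open import Function.Base using (_∘_)
open import Function.Bundles using (Equivalence; mk⇔; Bijection; mk⤖)
open import Relation.Binary.Definitions using (tri<; tri≈; tri>)
open import Relation.Binary.PropositionalEquality
open import Relation.Nullary using (¬_; yes; no; Dec; does; contradiction)
open import Relation.Nullary.Decidable using (dec-true; dec-false; does-⇔)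

-- Upper bound: a p-swap moves each of the n − 1 labels at a vertex by at most p, so it moves every
-- vertex sum by at most n p, and the spread of θt is at most α + 2 n p.
-- Lower bound: fix vertices u ≠ v. Exchanging the labels at positions a and a + p changes
-- s(u) − s(v) by p (σ a − σ (a + p)), where σ a = [u ∈ e_a] − [v ∈ e_a]. Exchanging a greedily chosen
-- disjoint family of improving pairs (a, a + p) is a p-swap, and counting the n − 1 edges at u and
-- the n − 1 edges at v shows that it gains p (2n − x − y − O(1)): x, y count edges of u, v near the ends
-- of the label range, pairs (a, a + p) of edges both at u (resp. both at v), and pairs skipped by the
-- greedy choice. An edge has two endpoints and two edges share at most one, so averaging over u and
-- then over v makes x and y at most about n/2 each, whence R ≥ p n − α − O(p) = p n − o(p n) as α = O(n) and p → ∞.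

ind : Bool → ℕ
ind true = 1
ind false = 0

T⇒≡true : ∀ {b} → T b → b ≡ true
T⇒≡true = Equivalence.to T-≡

¬T⇒≡false : ∀ {b} → ¬ T b → b ≡ false
¬T⇒≡false {true} ¬b = contradiction _ ¬b
¬T⇒≡false {false} _ = refl

does⇒ : ∀ {A : Set} (a? : Dec A) → T (does a?) → A
does⇒ (yes a) _ = a

⇒does : ∀ {A : Set} (a? : Dec A) → A → T (does a?)
⇒does a? a = subst T (sym (dec-true a? a)) _

does⇒-not : ∀ {A : Set} (a? : Dec A) → T (not (does a?)) → ¬ A
does⇒-not (no ¬a) _ = ¬a

⇒does-not : ∀ {A : Set} (a? : Dec A) → ¬ A → T (not (does a?))
⇒does-not a? ¬a = subst (T ∘ not) (sym (dec-false a? ¬a)) _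

T-ext : ∀ {a b} → (T a → T b) → (T b → T a) → a ≡ b
T-ext {true} {true} _ _ = refl
T-ext {true} {false} a⇒b _ = contradiction (a⇒b _) λ ()
T-ext {false} {true} _ b⇒a = contradiction (b⇒a _) λ ()
T-ext {false} {false} _ _ = refl

ind-∧ : ∀ a b → ind (a ∧ b) ≡ ind a * ind b
ind-∧ true b = sym (+-identityʳ (ind b))
ind-∧ false b = refl

ind-∧³ : ∀ a b c e → ind (a ∧ b ∧ c ∧ e) ≡ ind (a ∧ b ∧ c) * ind e
ind-∧³ true true true e = sym (+-identityʳ (ind e))
ind-∧³ true true false e = refl
ind-∧³ true false c e = refl
ind-∧³ false b c e = refl

ind-∨ : ∀ a b → ¬ (T a × T b) → ind (a ∨ b) ≡ ind a + ind b
ind-∨ true true ¬both = contradiction _ ¬both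
ind-∨ true false _ = refl
ind-∨ false b _ = refl

-- Inequalities between indicator expressions in k Boolean variables: by-truth-table k _ evaluates
-- all 2^k cases.
NatFn : ℕ → Set
NatFn zero = ℕ
NatFn (suc k) = Bool → NatFn k

PointwiseLe : ∀ k → NatFn k → NatFn k → Set
PointwiseLe zero m n = m ≤ n
PointwiseLe (suc k) f g = ∀ b → PointwiseLe k (f b) (g b)

pointwiseLe? : ∀ k → NatFn k → NatFn k → Bool
pointwiseLe? zero m n = m ≤ᵇ n
pointwiseLe? (suc k) f g = pointwiseLe? k (f true) (g true) ∧ pointwiseLe? k (f false) (g false)

by-truth-table : ∀ k {f g} → T (pointwiseLe? k f g) → PointwiseLe k f g
by-truth-table zero {m} {n} h = ≤ᵇ⇒≤ m n h
by-truth-table (suc k) h true = by-truth-table k (proj₁ (Equivalence.to T-∧ h))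
by-truth-table (suc k) {f} {g} h false =
  by-truth-table k (proj₂ (Equivalence.to (T-∧ {pointwiseLe? k (f true) (g true)}) h))

ind≤1 : ∀ b → ind b ≤ 1
ind≤1 = by-truth-table 1 _

ind-∧-≤ʳ : ∀ a b → ind (a ∧ b) ≤ ind b
ind-∧-≤ʳ = by-truth-table 2 _

ind-*-≤ : ∀ b m → ind b * m ≤ m
ind-*-≤ true m = ≤-reflexive (*-identityˡ m)
ind-*-≤ false m = z≤n

ind-split : ∀ a b → ind b ≤ ind a * ind b + ind (not a ∧ b)
ind-split = by-truth-table 2 _

sumFin≡∑ : ∀ n (f : Fin n → ℕ) → sumFin n f ≡ ∑[ i < n ] f i
sumFin≡∑ zero f = refl
sumFin≡∑ (suc n) f = cong (f F.zero +_) (sumFin≡∑ n (λ i → f (F.suc i)))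

sum-mono-≤ : ∀ {n} {f g : Fin n → ℕ} → (∀ i → f i ≤ g i) → sum f ≤ sum g
sum-mono-≤ {zero} f≤g = z≤n
sum-mono-≤ {suc n} f≤g = +-mono-≤ (f≤g F.zero) (sum-mono-≤ (λ i → f≤g (F.suc i)))

sum-const : ∀ n c → ∑[ i < n ] c ≡ n * c
sum-const zero c = refl
sum-const (suc n) c = cong (c +_) (sum-const n c)

sum-*ʳ : ∀ {n} (f : Fin n → ℕ) c → ∑[ i < n ] (f i * c) ≡ sum f * c
sum-*ʳ f c = trans (sum-cong-≗ (λ i → *-comm (f i) c)) (trans (sym (*-distribˡ-sum c f)) (*-comm c (sum f)))

sum-zero : ∀ n {f : Fin n → ℕ} → (∀ i → f i ≡ 0) → sum f ≡ 0
sum-zero n f≡0 = trans (sum-cong-≗ f≡0) (trans (sum-const n 0) (*-zeroʳ n))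

δ : ∀ {n} → Fin n → Fin n → ℕ
δ i j = ind (does (i FinP.≟ j))

sum-δ : ∀ {n} (i : Fin n) (h : Fin n → ℕ) → ∑[ j < n ] (δ i j * h j) ≡ h i
sum-δ {suc n} F.zero h = trans (cong (h F.zero + 0 +_) (sum-zero n λ j → refl)) (trans (+-identityʳ _) (+-identityʳ _))
sum-δ {suc n} (F.suc i) h = trans (sum-cong-≗ {n} λ j → cong (λ b → ind b * h (F.suc j)) (suc≟suc j)) (sum-δ i (λ j → h (F.suc j)))
  where
  suc≟suc : ∀ j → does (F.suc i FinP.≟ F.suc j) ≡ does (i FinP.≟ j)
  suc≟suc j = does-⇔ (mk⇔ FinP.suc-injective (cong F.suc)) (F.suc i FinP.≟ F.suc j) (i FinP.≟ j)

count-δ : ∀ {n} (i : Fin n) → ∑[ j < n ] δ i j ≡ 1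
count-δ i = trans (sum-cong-≗ λ j → sym (*-identityʳ (δ i j))) (sum-δ i (λ _ → 1))

count-others : ∀ {n} (i : Fin n) → ∑[ j < n ] ind (not (does (j FinP.≟ i))) + 1 ≡ n
count-others {n} i = begin
  ∑[ j < n ] ind (not (does (j FinP.≟ i))) + 1
    ≡⟨ cong (∑[ j < n ] ind (not (does (j FinP.≟ i))) +_) (sym (trans (sum-cong-≗ ≟-sym) (count-δ i))) ⟩
  ∑[ j < n ] ind (not (does (j FinP.≟ i))) + ∑[ j < n ] δ j i
    ≡⟨ sym (∑-distrib-+ (λ j → ind (not (does (j FinP.≟ i)))) (λ j → δ j i)) ⟩
  ∑[ j < n ] (ind (not (does (j FinP.≟ i))) + δ j i)
    ≡⟨ sum-cong-≗ (λ j → ind-not+ind (does (j FinP.≟ i))) ⟩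
  ∑[ j < n ] 1
    ≡⟨ trans (sum-const n 1) (*-identityʳ n) ⟩
  n ∎
  where
  open ≡-Reasoning
  ≟-sym : ∀ j → δ j i ≡ δ i j
  ≟-sym j = cong ind (does-⇔ (mk⇔ sym sym) (j FinP.≟ i) (i FinP.≟ j))
  ind-not+ind : ∀ b → ind (not b) + ind b ≡ 1
  ind-not+ind true = refl
  ind-not+ind false = refl

count-others-∸ : ∀ {n} (i : Fin n) → ∑[ j < n ] ind (not (does (j FinP.≟ i))) ≡ n ∸ 1
count-others-∸ {n} i = trans (sym (m+n∸n≡m (∑[ j < n ] ind (not (does (j FinP.≟ i)))) 1)) (cong (_∸ 1) (count-others i))

sumBelow : ℕ → (ℕ → ℕ) → ℕ
sumBelow m g = ∑[ i < m ] g (toℕ i)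

sumBelow-cong : ∀ m {f g : ℕ → ℕ} → (∀ a → a < m → f a ≡ g a) → sumBelow m f ≡ sumBelow m g
sumBelow-cong m f≡g = sum-cong-≗ (λ i → f≡g (toℕ i) (FinP.toℕ<n i))

sumBelow-mono-≤ : ∀ m {f g : ℕ → ℕ} → (∀ a → a < m → f a ≤ g a) → sumBelow m f ≤ sumBelow m g
sumBelow-mono-≤ m f≤g = sum-mono-≤ (λ i → f≤g (toℕ i) (FinP.toℕ<n i))

sumBelow-zero : ∀ m {f : ℕ → ℕ} → (∀ a → a < m → f a ≡ 0) → sumBelow m f ≡ 0
sumBelow-zero m f≡0 = sum-zero m (λ i → f≡0 (toℕ i) (FinP.toℕ<n i))

sumBelow-split : ∀ d m (g : ℕ → ℕ) → sumBelow (d + m) g ≡ sumBelow d g + sumBelow m (λ a → g (d + a))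
sumBelow-split zero m g = refl
sumBelow-split (suc d) m g = trans (cong (g 0 +_) (sumBelow-split d m (λ a → g (suc a)))) (sym (+-assoc (g 0) _ _))

sumBelow-distrib : ∀ m (f g : ℕ → ℕ) → sumBelow m (λ a → f a + g a) ≡ sumBelow m f + sumBelow m g
sumBelow-distrib m f g = ∑-distrib-+ {m} (f ∘ toℕ) (g ∘ toℕ)

sumBelow-distrib³ : ∀ m (f g h : ℕ → ℕ) → sumBelow m (λ a → f a + g a + h a) ≡ sumBelow m f + sumBelow m g + sumBelow m h
sumBelow-distrib³ m f g h = trans (sumBelow-distrib m (λ a → f a + g a) h) (cong (_+ sumBelow m h) (sumBelow-distrib m f g))

sumBelow-distrib⁴ : ∀ m (f g h k : ℕ → ℕ) →
  sumBelow m (λ a → f a + g a + h a + k a) ≡ sumBelow m f + sumBelow m g + sumBelow m h + sumBelow m k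
sumBelow-distrib⁴ m f g h k = trans (sumBelow-distrib m (λ a → f a + g a + h a) k) (cong (_+ sumBelow m k) (sumBelow-distrib³ m f g h))

sumBelow-* : ∀ m c (f : ℕ → ℕ) → c * sumBelow m f ≡ sumBelow m (λ a → c * f a)
sumBelow-* m c f = *-distribˡ-sum {m} c (f ∘ toℕ)

count≤ : ∀ m (P : ℕ → Bool) → sumBelow m (λ a → ind (P a)) ≤ m
count≤ m P = ≤-trans (sumBelow-mono-≤ m (λ a _ → ind≤1 (P a))) (≤-reflexive (trans (sum-const m 1) (*-identityʳ m)))

count-below≤ : ∀ E d → sumBelow E (λ x → ind (not (d ≤ᵇ x))) ≤ d
count-below≤ E d with ≤-total d E
... | inj₂ E≤d = ≤-trans (count≤ E (λ x → not (d ≤ᵇ x))) E≤d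
... | inj₁ d≤E = begin
  sumBelow E below                                             ≡⟨ cong (λ m → sumBelow m below) (sym (m+[n∸m]≡n d≤E)) ⟩
  sumBelow (d + (E ∸ d)) below                                 ≡⟨ sumBelow-split d (E ∸ d) below ⟩
  sumBelow d below + sumBelow (E ∸ d) (λ a → below (d + a))    ≡⟨ cong (sumBelow d below +_) (sumBelow-zero (E ∸ d) λ a _ → beyond a) ⟩
  sumBelow d below + 0                                         ≤⟨ +-monoˡ-≤ 0 (count≤ d (λ x → not (d ≤ᵇ x))) ⟩
  d + 0                                                        ≡⟨ +-identityʳ d ⟩
  d                                                            ∎
  where
  open ≤-Reasoning
  below : ℕ → ℕ
  below x = ind (not (d ≤ᵇ x))
  beyond : ∀ a → below (d + a) ≡ 0
  beyond a = cong (λ b → ind (not b)) (T⇒≡true (≤⇒≤ᵇ (m≤m+n d a)))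

count-above≤ : ∀ E d → sumBelow E (λ a → ind (not (a + d <ᵇ E))) ≤ d
count-above≤ E d with ≤-total d E
... | inj₂ E≤d = ≤-trans (count≤ E (λ a → not (a + d <ᵇ E))) E≤d
... | inj₁ d≤E = begin
  sumBelow E above                                             ≡⟨ cong (λ m → sumBelow m above) (sym (m∸n+n≡m d≤E)) ⟩
  sumBelow (E ∸ d + d) above                                   ≡⟨ sumBelow-split (E ∸ d) d above ⟩
  sumBelow (E ∸ d) above + sumBelow d (λ a → above (E ∸ d + a)) ≡⟨ cong (_+ sumBelow d (λ a → above (E ∸ d + a))) (sumBelow-zero (E ∸ d) within) ⟩
  0 + sumBelow d (λ a → above (E ∸ d + a))                     ≤⟨ count≤ d (λ a → not (E ∸ d + a + d <ᵇ E)) ⟩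
  d                                                            ∎
  where
  open ≤-Reasoning
  above : ℕ → ℕ
  above a = ind (not (a + d <ᵇ E))
  within : ∀ a → a < E ∸ d → above a ≡ 0
  within a a<E∸d = cong (λ b → ind (not b)) (T⇒≡true (<⇒<ᵇ (subst (a + d <_) (m∸n+n≡m d≤E) (+-monoˡ-< d a<E∸d))))

sumBelow-shift : ∀ E d (H : ℕ → ℕ) → (∀ a → E ≤ a + d → H a ≡ 0) →
  sumBelow E (λ x → ind (d ≤ᵇ x) * H (x ∸ d)) ≡ sumBelow E H
sumBelow-shift E d H vanish with ≤-total d E
... | inj₂ E≤d = trans (sumBelow-zero E λ x x<E → cong (λ b → ind b * H (x ∸ d)) (¬T⇒≡false (<⇒≱ (<-≤-trans x<E E≤d) ∘ ≤ᵇ⇒≤ d x)))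
                       (sym (sumBelow-zero E λ a _ → vanish a (≤-trans E≤d (m≤n+m d a))))
... | inj₁ d≤E = begin
  sumBelow E shifted                                                  ≡⟨ cong (λ k → sumBelow k shifted) (sym (m+[n∸m]≡n d≤E)) ⟩
  sumBelow (d + m) shifted                                            ≡⟨ sumBelow-split d m shifted ⟩
  sumBelow d shifted + sumBelow m (λ a → shifted (d + a))             ≡⟨ cong₂ _+_ (sumBelow-zero d below) (sumBelow-cong m λ a _ → above a) ⟩
  0 + sumBelow m H                                                    ≡⟨ +-comm 0 _ ⟩
  sumBelow m H + 0                                                    ≡⟨ cong (sumBelow m H +_) (sym (sumBelow-zero d λ a _ → tail a)) ⟩
  sumBelow m H + sumBelow d (λ a → H (m + a))                         ≡⟨ sym (sumBelow-split m d H) ⟩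
  sumBelow (m + d) H                                                  ≡⟨ cong (λ k → sumBelow k H) (m∸n+n≡m d≤E) ⟩
  sumBelow E H                                                        ∎
  where
  open ≡-Reasoning
  m = E ∸ d
  shifted : ℕ → ℕ
  shifted x = ind (d ≤ᵇ x) * H (x ∸ d)
  below : ∀ x → x < d → shifted x ≡ 0
  below x x<d = cong (λ b → ind b * H (x ∸ d)) (¬T⇒≡false (<⇒≱ x<d ∘ ≤ᵇ⇒≤ d x))
  above : ∀ a → shifted (d + a) ≡ H a
  above a = trans (cong (λ b → ind b * H (d + a ∸ d)) (T⇒≡true (≤⇒≤ᵇ (m≤m+n d a))))
                  (trans (+-identityʳ _) (cong H (m+n∸m≡n d a)))
  tail : ∀ a → H (m + a) ≡ 0
  tail a = vanish (m + a) (≤-trans (≤-reflexive (sym (m∸n+n≡m d≤E))) (+-monoˡ-≤ d (m≤m+n m a)))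

argmin : ∀ {n} (P : Fin n → Bool) (f : Fin n → ℕ) →
  (∀ j → ¬ T (P j)) ⊎ ∃[ i ] (T (P i) × (∀ j → T (P j) → f i ≤ f j))
argmin {zero} P f = inj₁ λ ()
argmin {suc n} P f with argmin (P ∘ F.suc) (f ∘ F.suc) | T? (P F.zero)
... | inj₁ none | no ¬P0 = inj₁ λ { F.zero → ¬P0 ; (F.suc j) → none j }
... | inj₁ none | yes P0 = inj₂ (F.zero , P0 , λ { F.zero _ → ≤-refl ; (F.suc j) Pj → contradiction Pj (none j) })
... | inj₂ (i , Pi , min) | no ¬P0 = inj₂ (F.suc i , Pi , λ { F.zero P0 → contradiction P0 ¬P0 ; (F.suc j) Pj → min j Pj })
... | inj₂ (i , Pi , min) | yes P0 with f F.zero ≤? f (F.suc i)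
...   | yes f0≤ = inj₂ (F.zero , P0 , λ { F.zero _ → ≤-refl ; (F.suc j) Pj → ≤-trans f0≤ (min j Pj) })
...   | no f0≰ = inj₂ (F.suc i , Pi , λ { F.zero _ → <⇒≤ (≰⇒> f0≰) ; (F.suc j) Pj → min j Pj })

∃-≤-average : ∀ {n} (P : Fin n → Bool) (f : Fin n → ℕ) (w : Fin n) → T (P w) →
  ∃[ i ] (T (P i) × (∑[ j < n ] ind (P j)) * f i ≤ ∑[ j < n ] (ind (P j) * f j))
∃-≤-average P f w Pw with argmin P f
... | inj₁ none = contradiction Pw (none w)
... | inj₂ (i , Pi , min) = i , Pi , ≤-trans (≤-reflexive (sym (sum-*ʳ (ind ∘ P) (f i)))) (sum-mono-≤ weighted)
  where
  weighted : ∀ j → ind (P j) * f i ≤ ind (P j) * f j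
  weighted j with P j in Pj
  ... | true = *-monoʳ-≤ 1 (min j (subst T (sym Pj) _))
  ... | false = z≤n

∣m-n∣≤o⇒m≤n+o : ∀ m n {o} → ∣ m - n ∣ ≤ o → m ≤ n + o
∣m-n∣≤o⇒m≤n+o m n h = ≤-trans (m≤n+∣m-n∣ m n) (+-monoʳ-≤ n h)

m≤n+o⇒n≤m+o⇒∣m-n∣≤o : ∀ m n {o} → m ≤ n + o → n ≤ m + o → ∣ m - n ∣ ≤ o
m≤n+o⇒n≤m+o⇒∣m-n∣≤o m n {o} m≤n+o n≤m+o with ∣m-n∣≡[m∸n]∨[n∸m] m n
... | inj₁ eq = subst (_≤ o) (sym eq) (m≤n+o⇒m∸n≤o m n m≤n+o)
... | inj₂ eq = subst (_≤ o) (sym eq) (m≤n+o⇒m∸n≤o n m n≤m+o)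

gain-transfer : ∀ {a b a′ b′ d L G L′ G′ S} → a′ + d * L ≡ a + d * G → b′ + d * L′ ≡ b + d * G′ →
  S + L + G′ ≤ G + L′ → a + b′ + d * S ≤ a′ + b
gain-transfer {a} {b} {a′} {b′} {d} {L} {G} {L′} {G′} {S} eqa eqb gain = +-cancelʳ-≤ (d * (L + G′)) _ _ (begin
  a + b′ + d * S + d * (L + G′)   ≡⟨ factor a b′ d S L G′ ⟩
  a + b′ + d * (S + L + G′)       ≤⟨ +-monoʳ-≤ (a + b′) (*-monoʳ-≤ d gain) ⟩
  a + b′ + d * (G + L′)           ≡⟨ split a b′ d G L′ ⟩
  (a + d * G) + (b′ + d * L′)     ≡⟨ cong₂ _+_ (sym eqa) eqb ⟩
  (a′ + d * L) + (b + d * G′)     ≡⟨ sym (split a′ b d L G′) ⟩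
  a′ + b + d * (L + G′)           ∎)
  where
  open ≤-Reasoning
  factor : ∀ a b d s l g → a + b + d * s + d * (l + g) ≡ a + b + d * (s + l + g)
  factor = solve-∀
  split : ∀ a b d g l → a + b + d * (g + l) ≡ (a + d * g) + (b + d * l)
  split = solve-∀

two-ε : ∀ n → 2 * ε n ≡ n * (n ∸ 1)
two-ε zero = refl
two-ε (suc m) = choose-2 m
  where
  choose-2 : ∀ m → 2 * (suc m C 2) ≡ suc m * m
  choose-2 zero = refl
  choose-2 (suc m) = begin
    2 * (suc (suc m) C 2)               ≡⟨ cong (2 *_) (sym (nCk+nC[k+1]≡[n+1]C[k+1] (suc m) 1)) ⟩
    2 * (suc m C 1 + suc m C 2)         ≡⟨ *-distribˡ-+ 2 (suc m C 1) (suc m C 2) ⟩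
    2 * (suc m C 1) + 2 * (suc m C 2)   ≡⟨ cong₂ (λ a b → 2 * a + b) (nC1≡n (suc m)) (choose-2 m) ⟩
    2 * suc m + suc m * m               ≡⟨ expand m ⟩
    suc (suc m) * suc m                 ∎
    where
    open ≡-Reasoning
    expand : ∀ m → 2 * suc m + suc m * m ≡ suc (suc m) * suc m
    expand = solve-∀

twice-first-choice≤ : ∀ {n d E x} → 1 ≤ n → 2 * E ≡ n * (n ∸ 1) → 2 * d ≤ n → n * x ≤ 2 * d + E → 2 * x ≤ n + 1
twice-first-choice≤ {suc k} {d} {E} {x} (s≤s z≤n) two-E 2d≤n bound = *-cancelˡ-≤ (suc k) (begin
  suc k * (2 * x)            ≡⟨ swap-factors (suc k) x ⟩
  2 * (suc k * x)            ≤⟨ *-monoʳ-≤ 2 bound ⟩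
  2 * (2 * d + E)            ≡⟨ *-distribˡ-+ 2 (2 * d) E ⟩
  2 * (2 * d) + 2 * E        ≤⟨ +-mono-≤ (*-monoʳ-≤ 2 2d≤n) (≤-reflexive two-E) ⟩
  2 * suc k + suc k * k      ≡⟨ collect k ⟩
  suc k * (suc k + 1)        ∎)
  where
  open ≤-Reasoning
  swap-factors : ∀ a b → a * (2 * b) ≡ 2 * (a * b)
  swap-factors = solve-∀
  collect : ∀ k → 2 * suc k + suc k * k ≡ suc k * (suc k + 1)
  collect = solve-∀

twice-second-choice≤ : ∀ {n d E y} → 2 ≤ n → 2 * E ≡ n * (n ∸ 1) → 2 * d ≤ n →
  (n ∸ 1) * y ≤ 2 * d + E + 4 * (n ∸ 1) → 2 * y ≤ n + 12
twice-second-choice≤ {suc (suc k)} {d} {E} {y} (s≤s (s≤s z≤n)) two-E 2d≤n bound = *-cancelˡ-≤ (suc k) (begin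
  suc k * (2 * y)                                   ≡⟨ swap-factors (suc k) y ⟩
  2 * (suc k * y)                                   ≤⟨ *-monoʳ-≤ 2 bound ⟩
  2 * (2 * d + E + 4 * suc k)                       ≡⟨ expand d E (suc k) ⟩
  2 * (2 * d) + 2 * E + 8 * suc k                   ≤⟨ +-monoˡ-≤ (8 * suc k) (+-mono-≤ (*-monoʳ-≤ 2 2d≤n) (≤-reflexive two-E)) ⟩
  2 * suc (suc k) + suc (suc k) * suc k + 8 * suc k ≤⟨ m≤m+n _ (2 * k) ⟩
  2 * suc (suc k) + suc (suc k) * suc k + 8 * suc k + 2 * k ≡⟨ collect k ⟩
  suc k * (suc (suc k) + 12)                        ∎)
  where
  open ≤-Reasoning
  swap-factors : ∀ a b → a * (2 * b) ≡ 2 * (a * b)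
  swap-factors = solve-∀
  expand : ∀ d E m → 2 * (2 * d + E + 4 * m) ≡ 2 * (2 * d) + 2 * E + 8 * m
  expand = solve-∀
  collect : ∀ k → 2 * suc (suc k) + suc (suc k) * suc k + 8 * suc k + 2 * k ≡ suc k * (suc (suc k) + 12)
  collect = solve-∀

twice-excess≤ : ∀ {n x y} → 2 * x ≤ n + 1 → 2 * y ≤ n + 12 → 2 * (x + y + 4) ≤ 2 * n + 21
twice-excess≤ {n} {x} {y} x≤ y≤ = begin
  2 * (x + y + 4)          ≡⟨ expand x y ⟩
  2 * x + 2 * y + 8        ≤⟨ +-monoˡ-≤ 8 (+-mono-≤ x≤ y≤) ⟩
  n + 1 + (n + 12) + 8     ≡⟨ collect n ⟩
  2 * n + 21               ∎
  where
  open ≤-Reasoning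
  expand : ∀ x y → 2 * (x + y + 4) ≡ 2 * x + 2 * y + 8
  expand = solve-∀
  collect : ∀ n → n + 1 + (n + 12) + 8 ≡ 2 * n + 21
  collect = solve-∀

spread≥ : ∀ {a b a′ b′ d n X α r} → a + b′ + d * (2 * n) ≤ a′ + b + d * X → b ≤ a + α → a′ ≤ b′ + r →
  2 * X ≤ 2 * n + 21 → 2 * (d * n) ≤ 2 * r + 2 * α + 21 * d
spread≥ {a} {b} {a′} {b′} {d} {n} {X} {α} {r} gain magic spread X≤ = +-cancelˡ-≤ (2 * (d * n)) _ _ (begin
  2 * (d * n) + 2 * (d * n)               ≡⟨ double d n ⟩
  2 * (d * (2 * n))                       ≤⟨ *-monoʳ-≤ 2 one-side ⟩
  2 * (r + α + d * X)                     ≡⟨ distribute r α d X ⟩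
  2 * r + 2 * α + d * (2 * X)             ≤⟨ +-monoʳ-≤ (2 * r + 2 * α) (*-monoʳ-≤ d X≤) ⟩
  2 * r + 2 * α + d * (2 * n + 21)        ≡⟨ collect r α d n ⟩
  2 * (d * n) + (2 * r + 2 * α + 21 * d)  ∎)
  where
  open ≤-Reasoning
  one-side : d * (2 * n) ≤ r + α + d * X
  one-side = +-cancelˡ-≤ (a + b′) _ _ (begin
    a + b′ + d * (2 * n)                  ≤⟨ gain ⟩
    a′ + b + d * X                        ≤⟨ +-monoˡ-≤ (d * X) (+-mono-≤ spread magic) ⟩
    b′ + r + (a + α) + d * X              ≡⟨ regroup a b′ r α (d * X) ⟩
    a + b′ + (r + α + d * X)              ∎)
    where
    regroup : ∀ a b r α z → b + r + (a + α) + z ≡ a + b + (r + α + z)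
    regroup = solve-∀
  double : ∀ d n → 2 * (d * n) + 2 * (d * n) ≡ 2 * (d * (2 * n))
  double = solve-∀
  distribute : ∀ r α d X → 2 * (r + α + d * X) ≡ 2 * r + 2 * α + d * (2 * X)
  distribute = solve-∀
  collect : ∀ r α d n → 2 * r + 2 * α + d * (2 * n + 21) ≡ 2 * (d * n) + (2 * r + 2 * α + 21 * d)
  collect = solve-∀

lower-asymptotic : ∀ {k d n α c r} → 2 * (d * n) ≤ 2 * r + 2 * α + 21 * d → 1 ≤ d → α ≤ c * n →
  2 * suc k * c ≤ d → 21 * suc k < n → k * (d * n) < suc k * r
lower-asymptotic {k} {d} {n} {α} {c} {r} bound 1≤d α≤ 2kc≤d 21k<n = *-cancelˡ-< 2 _ _ (+-cancelʳ-< (2 * (d * n)) _ _ (begin-strict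
  2 * (k * (d * n)) + 2 * (d * n)              ≡⟨ collect k d n ⟩
  suc k * (2 * (d * n))                        ≤⟨ *-monoʳ-≤ (suc k) bound ⟩
  suc k * (2 * r + 2 * α + 21 * d)             ≡⟨ expand (suc k) r α d ⟩
  2 * (suc k * r) + (2 * suc k * α + 21 * suc k * d) <⟨ +-monoʳ-< (2 * (suc k * r)) (+-mono-≤-< α-part d-part) ⟩
  2 * (suc k * r) + (d * n + d * n)            ≡⟨ cong (2 * (suc k * r) +_) (cong (d * n +_) (sym (+-identityʳ (d * n)))) ⟩
  2 * (suc k * r) + 2 * (d * n)                ∎))
  where
  open ≤-Reasoning
  collect : ∀ k d n → 2 * (k * (d * n)) + 2 * (d * n) ≡ suc k * (2 * (d * n))
  collect = solve-∀
  expand : ∀ k r α d → k * (2 * r + 2 * α + 21 * d) ≡ 2 * (k * r) + (2 * k * α + 21 * k * d)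
  expand = solve-∀
  α-part : 2 * suc k * α ≤ d * n
  α-part = begin
    2 * suc k * α            ≤⟨ *-monoʳ-≤ (2 * suc k) α≤ ⟩
    2 * suc k * (c * n)      ≡⟨ sym (*-assoc (2 * suc k) c n) ⟩
    2 * suc k * c * n        ≤⟨ *-monoˡ-≤ n 2kc≤d ⟩
    d * n                    ∎
  d-part : 21 * suc k * d < d * n
  d-part = begin-strict
    21 * suc k * d           ≡⟨ *-comm (21 * suc k) d ⟩
    d * (21 * suc k)         <⟨ *-monoʳ-< d {{>-nonZero 1≤d}} 21k<n ⟩
    d * n                    ∎

upper-asymptotic : ∀ {k n p α c R} → R ≤ α + 2 * (n * p) → 1 ≤ n → α ≤ c * n → suc (k * c) ≤ p →
  k * R < (2 * k + 1) * (p * n)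
upper-asymptotic {k} {n} {p} {α} {c} {R} R≤ 1≤n α≤ kc<p = begin-strict
  k * R                      ≤⟨ *-monoʳ-≤ k R≤ ⟩
  k * (α + 2 * (n * p))      ≡⟨ expand k α n p ⟩
  k * α + 2 * k * (p * n)    <⟨ +-monoˡ-< (2 * k * (p * n)) α-part ⟩
  p * n + 2 * k * (p * n)    ≡⟨ collect k p n ⟩
  (2 * k + 1) * (p * n)      ∎
  where
  open ≤-Reasoning
  expand : ∀ k α n p → k * (α + 2 * (n * p)) ≡ k * α + 2 * k * (p * n)
  expand = solve-∀
  collect : ∀ k p n → p * n + 2 * k * (p * n) ≡ (2 * k + 1) * (p * n)
  collect = solve-∀
  α-part : k * α < p * n
  α-part = begin-strict
    k * α                    ≤⟨ *-monoʳ-≤ k α≤ ⟩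
    k * (c * n)              ≡⟨ sym (*-assoc k c n) ⟩
    k * c * n                <⟨ *-monoˡ-< n {{>-nonZero 1≤n}} (n<1+n (k * c)) ⟩
    suc (k * c) * n          ≤⟨ *-monoˡ-≤ n kc<p ⟩
    p * n                    ∎

-- Edges of the complete graph and positions of labels

module _ {n : ℕ} where

  lo hi : Edge n → Fin n
  lo ((i , _) , _) = i
  hi ((_ , j) , _) = j

  lo<hi : (e : Edge n) → toℕ (lo e) < toℕ (hi e)
  lo<hi (_ , lt) = lt

  lo≢hi : (e : Edge n) → ¬ lo e ≡ hi e
  lo≢hi e eq = <-irrefl (cong toℕ eq) (lo<hi e)

  edge-≡ : {e e' : Edge n} → lo e ≡ lo e' → hi e ≡ hi e' → e ≡ e'
  edge-≡ {_ , lt} {_ , lt'} refl refl = cong (_ ,_) (<-irrelevant lt lt')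

  lo≢hi′ : ∀ w e → T (does (lo e FinP.≟ w)) → T (does (hi e FinP.≟ w)) → ⊥
  lo≢hi′ w e lo≡w hi≡w = lo≢hi e (trans (does⇒ (lo e FinP.≟ w) lo≡w) (sym (does⇒ (hi e FinP.≟ w) hi≡w)))

  _∈ᵉ_ : Fin n → Edge n → Bool
  w ∈ᵉ e = does (lo e FinP.≟ w) ∨ does (hi e FinP.≟ w)

  ind-∈ᵉ : ∀ w e → ind (w ∈ᵉ e) ≡ δ (lo e) w + δ (hi e) w
  ind-∈ᵉ w e = ind-∨ _ _ λ (lo≡w , hi≡w) → lo≢hi′ w e lo≡w hi≡w

  edgeValue : (Edge n → ℕ) → Fin n → Fin n → ℕ
  edgeValue g w u with FinP.<-cmp w u
  ... | tri< w<u _ _ = g ((w , u) , w<u)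
  ... | tri≈ _ _ _   = 0
  ... | tri> _ _ u<w = g ((u , w) , u<w)

  edgeValue-cong : ∀ {g g′ : Edge n → ℕ} → (∀ e → g e ≡ g′ e) → ∀ w u → edgeValue g w u ≡ edgeValue g′ w u
  edgeValue-cong g≗g′ w u with FinP.<-cmp w u
  ... | tri< _ _ _ = g≗g′ _
  ... | tri≈ _ _ _ = refl
  ... | tri> _ _ _ = g≗g′ _

  pairLabel≡edgeValue : ∀ (t : Labeling n) w u → pairLabel t w u ≡ edgeValue (label t) w u
  pairLabel≡edgeValue t w u with FinP.<-cmp w u
  ... | tri< _ _ _ = refl
  ... | tri≈ _ _ _ = refl
  ... | tri> _ _ _ = refl

  joins : Fin n → Fin n → Edge n → Bool
  joins w u e = (does (lo e FinP.≟ w) ∧ does (hi e FinP.≟ u)) ∨ (does (lo e FinP.≟ u) ∧ does (hi e FinP.≟ w))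

  joins-sym : ∀ w u e → joins w u e ≡ joins u w e
  joins-sym w u e = ∨-comm (does (lo e FinP.≟ w) ∧ does (hi e FinP.≟ u)) _

  ¬joins-loop : ∀ w e → ¬ T (joins w w e)
  ¬joins-loop w e h = [ loop , loop ]′ (Equivalence.to T-∨ h)
    where
    loop : T (does (lo e FinP.≟ w) ∧ does (hi e FinP.≟ w)) → ⊥
    loop lh = let lo≡w , hi≡w = Equivalence.to T-∧ lh in lo≢hi′ w e lo≡w hi≡w

  joins-< : ∀ {w u} (w<u : toℕ w < toℕ u) e → T (joins w u e) → ((w , u) , w<u) ≡ e
  joins-< w<u e h with Equivalence.to T-∨ h
  ... | inj₁ wu = let lo≡w , hi≡u = Equivalence.to T-∧ wu in
    edge-≡ (sym (does⇒ (lo e FinP.≟ _) lo≡w)) (sym (does⇒ (hi e FinP.≟ _) hi≡u))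
  ... | inj₂ uw = let lo≡u , hi≡w = Equivalence.to T-∧ uw in
    contradiction (subst₂ (λ i j → toℕ i < toℕ j) (does⇒ (lo e FinP.≟ _) lo≡u) (does⇒ (hi e FinP.≟ _) hi≡w) (lo<hi e)) (<⇒≯ w<u)

  joins-edge : ∀ {w u} (w<u : toℕ w < toℕ u) → T (joins w u ((w , u) , w<u))
  joins-edge {w} {u} _ rewrite dec-true (w FinP.≟ w) refl | dec-true (u FinP.≟ u) refl = _

  count-joins : ∀ u e → ∑[ w < n ] ind (joins w u e) ≡ ind (u ∈ᵉ e)
  count-joins u e = begin
    ∑[ w < n ] ind (joins w u e)                                   ≡⟨ sum-cong-≗ split ⟩
    ∑[ w < n ] (δ (lo e) w * δ (hi e) u + δ (hi e) w * δ (lo e) u)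
      ≡⟨ ∑-distrib-+ (λ w → δ (lo e) w * δ (hi e) u) (λ w → δ (hi e) w * δ (lo e) u) ⟩
    ∑[ w < n ] (δ (lo e) w * δ (hi e) u) + ∑[ w < n ] (δ (hi e) w * δ (lo e) u)
      ≡⟨ cong₂ _+_ (sum-δ (lo e) (λ _ → δ (hi e) u)) (sum-δ (hi e) (λ _ → δ (lo e) u)) ⟩
    δ (hi e) u + δ (lo e) u                                         ≡⟨ +-comm (δ (hi e) u) (δ (lo e) u) ⟩
    δ (lo e) u + δ (hi e) u                                         ≡⟨ sym (ind-∈ᵉ u e) ⟩
    ind (u ∈ᵉ e)                                                    ∎
    where
    open ≡-Reasoning
    split : ∀ w → ind (joins w u e) ≡ δ (lo e) w * δ (hi e) u + δ (hi e) w * δ (lo e) u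
    split w = trans (ind-∨ _ _ λ (wu , uw) → lo≢hi′ w e (proj₁ (Equivalence.to T-∧ wu)) (proj₂ (Equivalence.to T-∧ uw)))
                    (cong₂ _+_ (ind-∧ (does (lo e FinP.≟ w)) (does (hi e FinP.≟ u)))
                               (trans (ind-∧ (does (lo e FinP.≟ u)) (does (hi e FinP.≟ w))) (*-comm (δ (lo e) u) _)))

  ∈ᵉ-cases : ∀ w e → T (w ∈ᵉ e) → lo e ≡ w ⊎ hi e ≡ w
  ∈ᵉ-cases w e w∈e with Equivalence.to T-∨ w∈e
  ... | inj₁ lo≡w = inj₁ (does⇒ (lo e FinP.≟ w) lo≡w)
  ... | inj₂ hi≡w = inj₂ (does⇒ (hi e FinP.≟ w) hi≡w)

  count-endpoints : ∀ e → ∑[ w < n ] ind (w ∈ᵉ e) ≡ 2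
  count-endpoints e = begin
    ∑[ w < n ] ind (w ∈ᵉ e)                                       ≡⟨ sum-cong-≗ (λ w → ind-∈ᵉ w e) ⟩
    ∑[ w < n ] (δ (lo e) w + δ (hi e) w)
      ≡⟨ ∑-distrib-+ (λ w → δ (lo e) w) (λ w → δ (hi e) w) ⟩
    ∑[ w < n ] δ (lo e) w + ∑[ w < n ] δ (hi e) w
      ≡⟨ cong₂ _+_ (count-δ (lo e)) (count-δ (hi e)) ⟩
    2                                                             ∎
    where open ≡-Reasoning

  endpoints⇒≡ : ∀ e e′ → T (lo e ∈ᵉ e′) → T (hi e ∈ᵉ e′) → e ≡ e′
  endpoints⇒≡ e e′ lo∈ hi∈ with ∈ᵉ-cases (lo e) e′ lo∈ | ∈ᵉ-cases (hi e) e′ hi∈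
  ... | inj₁ lo≡lo | inj₁ lo≡hi = contradiction (trans (sym lo≡lo) lo≡hi) (lo≢hi e)
  ... | inj₁ lo≡lo | inj₂ hi≡hi = edge-≡ (sym lo≡lo) (sym hi≡hi)
  ... | inj₂ hi≡lo | inj₁ lo≡hi = contradiction (subst₂ (λ i j → toℕ i < toℕ j) lo≡hi hi≡lo (lo<hi e′)) (<⇒≯ (lo<hi e))
  ... | inj₂ hi≡lo | inj₂ hi≡hi = contradiction (trans (sym hi≡lo) hi≡hi) (lo≢hi e)

  shared-endpoints≤1 : ∀ e e′ → ¬ e ≡ e′ → ∑[ w < n ] ind (w ∈ᵉ e ∧ w ∈ᵉ e′) ≤ 1
  shared-endpoints≤1 e e′ e≢e′ = begin
    ∑[ w < n ] ind (w ∈ᵉ e ∧ w ∈ᵉ e′)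
      ≡⟨ sum-cong-≗ (λ w → trans (ind-∧ (w ∈ᵉ e) (w ∈ᵉ e′)) (cong (_* ind (w ∈ᵉ e′)) (ind-∈ᵉ w e))) ⟩
    ∑[ w < n ] ((δ (lo e) w + δ (hi e) w) * ind (w ∈ᵉ e′))
      ≡⟨ sum-cong-≗ (λ w → *-distribʳ-+ (ind (w ∈ᵉ e′)) (δ (lo e) w) _) ⟩
    ∑[ w < n ] (δ (lo e) w * ind (w ∈ᵉ e′) + δ (hi e) w * ind (w ∈ᵉ e′))
      ≡⟨ ∑-distrib-+ (λ w → δ (lo e) w * ind (w ∈ᵉ e′)) (λ w → δ (hi e) w * ind (w ∈ᵉ e′)) ⟩
    ∑[ w < n ] (δ (lo e) w * ind (w ∈ᵉ e′)) + ∑[ w < n ] (δ (hi e) w * ind (w ∈ᵉ e′))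
      ≡⟨ cong₂ _+_ (sum-δ (lo e) (λ w → ind (w ∈ᵉ e′))) (sum-δ (hi e) (λ w → ind (w ∈ᵉ e′))) ⟩
    ind (lo e ∈ᵉ e′) + ind (hi e ∈ᵉ e′)
      ≡⟨ sym (ind-∨ (lo e ∈ᵉ e′) (hi e ∈ᵉ e′) (λ (lo∈ , hi∈) → e≢e′ (endpoints⇒≡ e e′ lo∈ hi∈))) ⟩
    ind (lo e ∈ᵉ e′ ∨ hi e ∈ᵉ e′)
      ≤⟨ ind≤1 _ ⟩
    1                                                             ∎
    where open ≤-Reasoning

  endpoints⇒joins : ∀ u v e → ¬ u ≡ v → T (u ∈ᵉ e) → T (v ∈ᵉ e) → T (joins v u e)
  endpoints⇒joins u v e u≢v u∈ v∈ with ∈ᵉ-cases u e u∈ | ∈ᵉ-cases v e v∈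
  ... | inj₁ lo≡u | inj₁ lo≡v = contradiction (trans (sym lo≡u) lo≡v) u≢v
  ... | inj₁ lo≡u | inj₂ hi≡v = Equivalence.from T-∨ (inj₂ (Equivalence.from T-∧ (⇒does (lo e FinP.≟ u) lo≡u , ⇒does (hi e FinP.≟ v) hi≡v)))
  ... | inj₂ hi≡u | inj₁ lo≡v = Equivalence.from T-∨ (inj₁ (Equivalence.from T-∧ (⇒does (lo e FinP.≟ v) lo≡v , ⇒does (hi e FinP.≟ u) hi≡u)))
  ... | inj₂ hi≡u | inj₂ hi≡v = contradiction (trans (sym hi≡u) hi≡v) u≢v

  edgeValue-1 : ∀ w u → edgeValue (λ _ → 1) w u ≡ ind (not (does (w FinP.≟ u)))
  edgeValue-1 w u with FinP.<-cmp w u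
  ... | tri< _ w≢u _ = cong (λ b → ind (not b)) (sym (dec-false (w FinP.≟ u) w≢u))
  ... | tri≈ _ w≡u _ = cong (λ b → ind (not b)) (sym (dec-true (w FinP.≟ u) w≡u))
  ... | tri> _ w≢u _ = cong (λ b → ind (not b)) (sym (dec-false (w FinP.≟ u) w≢u))

  edgeValue-≤ : ∀ {g h : Edge n → ℕ} {p} → (∀ e → g e ≤ h e + p) → ∀ w u → edgeValue g w u ≤ edgeValue h w u + p
  edgeValue-≤ g≤h w u with FinP.<-cmp w u
  ... | tri< _ _ _ = g≤h _
  ... | tri≈ _ _ _ = z≤n
  ... | tri> _ _ _ = g≤h _

  vertexSum-≤ : ∀ {t t′ : Labeling n} {p} → (∀ e → label t′ e ≤ label t e + p) → ∀ w → s t′ w ≤ s t w + n * p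
  vertexSum-≤ {t} {t′} {p} label≤ w = begin
    s t′ w                                          ≡⟨ sumFin≡∑ n (λ u → pairLabel t′ u w) ⟩
    ∑[ u < n ] pairLabel t′ u w                     ≡⟨ sum-cong-≗ (λ u → pairLabel≡edgeValue t′ u w) ⟩
    ∑[ u < n ] edgeValue (label t′) u w             ≤⟨ sum-mono-≤ (λ u → edgeValue-≤ label≤ u w) ⟩
    ∑[ u < n ] (edgeValue (label t) u w + p)        ≡⟨ ∑-distrib-+ (λ u → edgeValue (label t) u w) (λ _ → p) ⟩
    ∑[ u < n ] edgeValue (label t) u w + ∑[ u < n ] p ≡⟨ cong₂ _+_ (sym (sum-cong-≗ (λ u → pairLabel≡edgeValue t u w))) (sum-const n p) ⟩
    ∑[ u < n ] pairLabel t u w + n * p              ≡⟨ cong (_+ n * p) (sym (sumFin≡∑ n (λ u → pairLabel t u w))) ⟩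
    s t w + n * p                                   ∎
    where open ≤-Reasoning

  pSwap-spread≤ : ∀ {t t′ : Labeling n} {p α} → AlmostSupermagic α t → IsPSwapOf p t t′ →
    ∀ u v → ∣ s t′ u - s t′ v ∣ ≤ α + 2 * (n * p)
  pSwap-spread≤ {t} {t′} {p} {α} magic swap u v = m≤n+o⇒n≤m+o⇒∣m-n∣≤o (s t′ u) (s t′ v) (via u v) (via v u)
    where
    up≤ : ∀ w → s t′ w ≤ s t w + n * p
    up≤ = vertexSum-≤ (λ e → ∣m-n∣≤o⇒m≤n+o (label t′ e) (label t e) (subst (_≤ p) (∣-∣-comm (label t e) (label t′ e)) (swap e)))
    down≤ : ∀ w → s t w ≤ s t′ w + n * p
    down≤ = vertexSum-≤ (λ e → ∣m-n∣≤o⇒m≤n+o (label t e) (label t′ e) (swap e))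
    via : ∀ x y → s t′ x ≤ s t′ y + (α + 2 * (n * p))
    via x y = begin
      s t′ x                              ≤⟨ up≤ x ⟩
      s t x + n * p                       ≤⟨ +-monoˡ-≤ (n * p) (∣m-n∣≤o⇒m≤n+o (s t x) (s t y) (magic x y)) ⟩
      s t y + α + n * p                   ≤⟨ +-monoˡ-≤ (n * p) (+-monoˡ-≤ α (down≤ y)) ⟩
      s t′ y + n * p + α + n * p          ≡⟨ regroup (s t′ y) (n * p) α ⟩
      s t′ y + (α + 2 * (n * p))          ∎
      where
      open ≤-Reasoning
      regroup : ∀ a b c → a + b + c + b ≡ a + (c + 2 * b)
      regroup = solve-∀

module Positions {n : ℕ} (t : Labeling n) where

  E : ℕ
  E = ε n

  position : Edge n → Fin E
  position = Bijection.to t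

  edgeAt : Fin E → Edge n
  edgeAt a = proj₁ (Bijection.surjective t a)

  position-edgeAt : ∀ a → position (edgeAt a) ≡ a
  position-edgeAt a = proj₂ (Bijection.surjective t a) refl

  edgeAt-position : ∀ e → edgeAt (position e) ≡ e
  edgeAt-position e = Bijection.injective t (position-edgeAt (position e))

  joins-edgeAt : ∀ {w u} (w<u : toℕ w < toℕ u) a → joins w u (edgeAt a) ≡ does (position ((w , u) , w<u) FinP.≟ a)
  joins-edgeAt w<u a = T-ext
    (λ j → ⇒does (_ FinP.≟ a) (trans (cong position (joins-< w<u (edgeAt a) j)) (position-edgeAt a)))
    (λ p → subst (T ∘ joins _ _) (trans (sym (edgeAt-position _)) (cong edgeAt (does⇒ (_ FinP.≟ a) p))) (joins-edge w<u))

  sum-joins : ∀ {w u} (w<u : toℕ w < toℕ u) (h : Fin E → ℕ) →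
    ∑[ a < E ] (ind (joins w u (edgeAt a)) * h a) ≡ h (position ((w , u) , w<u))
  sum-joins w<u h = trans (sum-cong-≗ λ a → cong (λ b → ind b * h a) (joins-edgeAt w<u a)) (sum-δ _ h)

  edgeValue-as-sum : ∀ (h : Fin E → ℕ) w u → edgeValue (h ∘ position) w u ≡ ∑[ a < E ] (ind (joins w u (edgeAt a)) * h a)
  edgeValue-as-sum h w u with FinP.<-cmp w u
  ... | tri< w<u _ _ = sym (sum-joins w<u h)
  ... | tri≈ _ refl _ = sym (sum-zero E λ a → cong (λ b → ind b * h a) (¬T⇒≡false (¬joins-loop w (edgeAt a))))
  ... | tri> _ _ u<w = sym (trans (sum-cong-≗ λ a → cong (λ b → ind b * h a) (joins-sym w u (edgeAt a))) (sum-joins u<w h))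

  vertexSum : ∀ (h : Fin E → ℕ) u → ∑[ w < n ] edgeValue (h ∘ position) w u ≡ ∑[ a < E ] (ind (u ∈ᵉ edgeAt a) * h a)
  vertexSum h u = begin
    ∑[ w < n ] edgeValue (h ∘ position) w u                          ≡⟨ sum-cong-≗ (λ w → edgeValue-as-sum h w u) ⟩
    ∑[ w < n ] ∑[ a < E ] (ind (joins w u (edgeAt a)) * h a)         ≡⟨ ∑-comm (λ w a → ind (joins w u (edgeAt a)) * h a) ⟩
    ∑[ a < E ] ∑[ w < n ] (ind (joins w u (edgeAt a)) * h a)         ≡⟨ sum-cong-≗ (λ a → sum-*ʳ (λ w → ind (joins w u (edgeAt a))) (h a)) ⟩
    ∑[ a < E ] ((∑[ w < n ] ind (joins w u (edgeAt a))) * h a)       ≡⟨ sum-cong-≗ (λ a → cong (_* h a) (count-joins u (edgeAt a))) ⟩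
    ∑[ a < E ] (ind (u ∈ᵉ edgeAt a) * h a)                           ∎
    where open ≡-Reasoning

  -- Position x stands for the label x + 1; no edge sits at a position x ≥ ε n.
  incident : Fin n → ℕ → Bool
  incident w x with x <? E
  ... | yes x<E = w ∈ᵉ edgeAt (fromℕ< x<E)
  ... | no _ = false

  incident-toℕ : ∀ w a → incident w (toℕ a) ≡ w ∈ᵉ edgeAt a
  incident-toℕ w a with toℕ a <? E
  ... | yes a<E = cong (λ b → w ∈ᵉ edgeAt b) (FinP.fromℕ<-toℕ a a<E)
  ... | no a≮E = contradiction (FinP.toℕ<n a) a≮E

  incident-fromℕ< : ∀ w {x} (x<E : x < E) → incident w x ≡ w ∈ᵉ edgeAt (fromℕ< x<E)
  incident-fromℕ< w {x} x<E = trans (cong (incident w) (sym (FinP.toℕ-fromℕ< x<E))) (incident-toℕ w (fromℕ< x<E))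

  vertexSum-byPosition : ∀ (t′ : Labeling n) (f : ℕ → ℕ) → (∀ e → label t′ e ≡ suc (f (toℕ (position e)))) →
    ∀ w → s t′ w ≡ sumBelow E (λ x → ind (incident w x) * suc (f x))
  vertexSum-byPosition t′ f label≡ w = begin
    s t′ w                                                 ≡⟨ sumFin≡∑ n (λ u → pairLabel t′ u w) ⟩
    ∑[ u < n ] pairLabel t′ u w                            ≡⟨ sum-cong-≗ (λ u → trans (pairLabel≡edgeValue t′ u w) (edgeValue-cong label≡ u w)) ⟩
    ∑[ u < n ] edgeValue (h ∘ position) u w                ≡⟨ vertexSum h w ⟩
    ∑[ a < E ] (ind (w ∈ᵉ edgeAt a) * h a)                 ≡⟨ sum-cong-≗ (λ a → cong (λ b → ind b * h a) (sym (incident-toℕ w a))) ⟩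
    sumBelow E (λ x → ind (incident w x) * suc (f x))      ∎
    where
    open ≡-Reasoning
    h : Fin E → ℕ
    h a = suc (f (toℕ a))

  degree : ∀ w → sumBelow E (λ x → ind (incident w x)) + 1 ≡ n
  degree w = begin
    sumBelow E (λ x → ind (incident w x)) + 1
      ≡⟨ cong (_+ 1) (sum-cong-≗ λ a → trans (cong ind (incident-toℕ w a)) (sym (*-identityʳ _))) ⟩
    ∑[ a < E ] (ind (w ∈ᵉ edgeAt a) * 1) + 1
      ≡⟨ cong (_+ 1) (sym (vertexSum (λ _ → 1) w)) ⟩
    ∑[ u < n ] edgeValue (λ _ → 1) u w + 1
      ≡⟨ cong (_+ 1) (sum-cong-≗ λ u → edgeValue-1 u w) ⟩
    ∑[ u < n ] ind (not (does (u FinP.≟ w))) + 1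
      ≡⟨ count-others w ⟩
    n ∎
    where open ≡-Reasoning

  count-incident : ∀ {x} → x < E → ∑[ w < n ] ind (incident w x) ≡ 2
  count-incident x<E = trans (sum-cong-≗ λ w → cong ind (incident-fromℕ< w x<E)) (count-endpoints (edgeAt (fromℕ< x<E)))

  shared-incident≤1 : ∀ {x y} → x < E → y < E → ¬ x ≡ y → ∑[ w < n ] ind (incident w x ∧ incident w y) ≤ 1
  shared-incident≤1 {x} {y} x<E y<E x≢y = subst (_≤ 1)
    (sum-cong-≗ λ w → sym (cong₂ (λ b c → ind (b ∧ c)) (incident-fromℕ< w x<E) (incident-fromℕ< w y<E)))
    (shared-endpoints≤1 _ _ λ eq → x≢y (begin
      x                                    ≡⟨ sym (FinP.toℕ-fromℕ< x<E) ⟩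
      toℕ (fromℕ< x<E)                     ≡⟨ cong toℕ (trans (sym (position-edgeAt _)) (trans (cong position eq) (position-edgeAt _))) ⟩
      toℕ (fromℕ< y<E)                     ≡⟨ FinP.toℕ-fromℕ< y<E ⟩
      y                                    ∎))
    where open ≡-Reasoning

  common-incident≤1 : ∀ {u v} → ¬ u ≡ v → sumBelow E (λ x → ind (incident u x ∧ incident v x)) ≤ 1
  common-incident≤1 {u} {v} u≢v = begin
    sumBelow E (λ x → ind (incident u x ∧ incident v x))
      ≡⟨ sum-cong-≗ (λ a → cong₂ (λ b c → ind (b ∧ c)) (incident-toℕ u a) (incident-toℕ v a)) ⟩
    ∑[ a < E ] ind (u ∈ᵉ edgeAt a ∧ v ∈ᵉ edgeAt a)
      ≤⟨ sum-mono-≤ (λ a → both⇒joins (edgeAt a)) ⟩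
    ∑[ a < E ] (ind (joins v u (edgeAt a)) * 1)
      ≡⟨ sym (edgeValue-as-sum (λ _ → 1) v u) ⟩
    edgeValue (λ _ → 1) v u
      ≡⟨ edgeValue-1 v u ⟩
    ind (not (does (v FinP.≟ u)))
      ≤⟨ ind≤1 _ ⟩
    1 ∎
    where
    open ≤-Reasoning
    both⇒joins : ∀ e → ind (u ∈ᵉ e ∧ v ∈ᵉ e) ≤ ind (joins v u e) * 1
    both⇒joins e with T? (u ∈ᵉ e ∧ v ∈ᵉ e)
    ... | no ¬both = ≤-trans (≤-reflexive (cong ind (¬T⇒≡false ¬both))) z≤n
    ... | yes both = let u∈ , v∈ = Equivalence.to T-∧ both in
      ≤-reflexive (trans (cong ind (T⇒≡true both)) (sym (trans (*-identityʳ _) (cong ind (T⇒≡true (endpoints⇒joins u v e u≢v u∈ v∈))))))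

  module Relabel (π : ℕ → ℕ) (π<E : ∀ x → x < E → π x < E) (π-involutive : ∀ x → π (π x) ≡ x) where

    πᶠ : Fin E → Fin E
    πᶠ a = fromℕ< (π<E (toℕ a) (FinP.toℕ<n a))

    toℕ-πᶠ : ∀ a → toℕ (πᶠ a) ≡ π (toℕ a)
    toℕ-πᶠ a = FinP.toℕ-fromℕ< _

    πᶠ-involutive : ∀ a → πᶠ (πᶠ a) ≡ a
    πᶠ-involutive a = FinP.toℕ-injective (trans (toℕ-πᶠ (πᶠ a)) (trans (cong π (toℕ-πᶠ a)) (π-involutive (toℕ a))))

    relabel : Labeling n
    relabel = mk⤖ {to = πᶠ ∘ position} (injective , surjective)
      where
      injective : ∀ {e e′} → πᶠ (position e) ≡ πᶠ (position e′) → e ≡ e′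
      injective eq = Bijection.injective t (trans (sym (πᶠ-involutive _)) (trans (cong πᶠ eq) (πᶠ-involutive _)))
      surjective : ∀ a → ∃[ e ] (∀ {e′} → e′ ≡ e → πᶠ (position e′) ≡ a)
      surjective a = edgeAt (πᶠ a) , λ { refl → trans (cong πᶠ (position-edgeAt (πᶠ a))) (πᶠ-involutive a) }

    label-relabel : ∀ e → label relabel e ≡ suc (π (toℕ (position e)))
    label-relabel e = cong suc (toℕ-πᶠ (position e))

    relabel-isPSwap : ∀ {d} → (∀ x → ∣ x - π x ∣ ≤ d) → IsPSwapOf d t relabel
    relabel-isPSwap {d} moves≤d e =
      subst (λ y → ∣ suc (toℕ (position e)) - suc y ∣ ≤ d) (sym (toℕ-πᶠ (position e))) (moves≤d (toℕ (position e)))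

    vertexSum-relabel : ∀ w → s relabel w ≡ sumBelow E (λ x → ind (incident w x) * suc (π x))
    vertexSum-relabel = vertexSum-byPosition relabel π label-relabel

  vertexSum-positions : ∀ w → s t w ≡ sumBelow E (λ x → ind (incident w x) * suc x)
  vertexSum-positions = vertexSum-byPosition t (λ x → x) (λ e → refl)

-- The greedy swap

-- level x y − 1 is σ of an edge with x = [u ∈ e] and y = [v ∈ e]; Improves compares the edges at a and a + d.
level : Bool → Bool → ℕ
level x y = ind x + (1 ∸ ind y)

Improves : Bool → Bool → Bool → Bool → Bool
Improves x y x′ y′ = level x′ y′ <ᵇ level x y

GainU : Bool → Bool → Bool → Bool → Bool
GainU f x y x′ = f ∧ (x ∧ not y) ∧ not x′

GainV : Bool → Bool → Bool → Bool → Bool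
GainV f y x′ y′ = f ∧ (not x′ ∧ y′) ∧ not y

gain-covers : ∀ f x y x′ y′ keep → let sel = (f ∧ Improves x y x′ y′) ∧ keep in
  ind (sel ∧ GainU f x y x′) + ind (sel ∧ GainV f y x′ y′) + ind (sel ∧ x′) + ind (sel ∧ y) ≤ ind (sel ∧ x) + ind (sel ∧ y′)
gain-covers = by-truth-table 6 _

gains-skipped : ∀ f x y x′ y′ b f₀ x₀ y₀ → let sel = (f ∧ Improves x y x′ y′) ∧ not (b ∧ (f₀ ∧ Improves x₀ y₀ x y)) in
  ind (GainU f x y x′) + ind (GainV f y x′ y′) ≤ ind (sel ∧ GainU f x y x′) + ind (sel ∧ GainV f y x′ y′) + 2 * ind (b ∧ f ∧ x₀ ∧ y′)
gains-skipped = by-truth-table 9 _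

degree-splitU : ∀ f x y x′ → ind x ≤ ind (GainU f x y x′) + ind (x ∧ not f) + ind (f ∧ x ∧ x′) + ind (x ∧ y)
degree-splitU = by-truth-table 4 _

degree-splitV : ∀ f y x′ y′ → ind (f ∧ y′) ≤ ind (GainV f y x′ y′) + ind (f ∧ x′ ∧ y′) + ind (f ∧ y ∧ y′)
degree-splitV = by-truth-table 4 _

module DisplacementCounts {n : ℕ} (t : Labeling n) (d : ℕ) where
  open Positions t

  fits : ℕ → Bool
  fits a = a + d <ᵇ E

  late early repeats : Fin n → ℕ
  late w = sumBelow E (λ a → ind (incident w a ∧ not (fits a)))
  early w = sumBelow E (λ x → ind (not (d ≤ᵇ x) ∧ incident w x))
  repeats w = sumBelow E (λ a → ind (fits a ∧ incident w a ∧ incident w (a + d)))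

  chains : Fin n → Fin n → ℕ
  chains u w = sumBelow E (λ a → ind ((d ≤ᵇ a) ∧ fits a ∧ incident u (a ∸ d) ∧ incident w (a + d)))

  sum-incident : ∀ (c : ℕ → ℕ) → ∑[ w < n ] sumBelow E (λ a → c a * ind (incident w a)) ≡ 2 * sumBelow E c
  sum-incident c = begin
    ∑[ w < n ] sumBelow E (λ a → c a * ind (incident w a))   ≡⟨ ∑-comm {n} {E} (λ w a → c (toℕ a) * ind (incident w (toℕ a))) ⟩
    ∑[ a < E ] ∑[ w < n ] (c (toℕ a) * ind (incident w (toℕ a)))
      ≡⟨ sum-cong-≗ {E} (λ a → trans (sym (*-distribˡ-sum (c (toℕ a)) (λ w → ind (incident w (toℕ a)))))
                                 (trans (cong (c (toℕ a) *_) (count-incident (FinP.toℕ<n a))) (*-comm (c (toℕ a)) 2))) ⟩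
    ∑[ a < E ] (2 * c (toℕ a))                               ≡⟨ sym (*-distribˡ-sum {E} 2 (c ∘ toℕ)) ⟩
    2 * sumBelow E c                                         ∎
    where open ≡-Reasoning

  sum-late : ∑[ w < n ] late w ≤ 2 * d
  sum-late = begin
    ∑[ w < n ] late w
      ≡⟨ sum-cong-≗ (λ w → sumBelow-cong E λ a _ → trans (ind-∧ (incident w a) (not (fits a))) (*-comm (ind (incident w a)) _)) ⟩
    ∑[ w < n ] sumBelow E (λ a → ind (not (fits a)) * ind (incident w a))
      ≡⟨ sum-incident (λ a → ind (not (fits a))) ⟩
    2 * sumBelow E (λ a → ind (not (fits a)))                ≤⟨ *-monoʳ-≤ 2 (count-above≤ E d) ⟩
    2 * d                                                    ∎
    where open ≤-Reasoning

  sum-early : ∑[ w < n ] early w ≤ 2 * d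
  sum-early = begin
    ∑[ w < n ] early w
      ≡⟨ sum-cong-≗ (λ w → sumBelow-cong E λ x _ → ind-∧ (not (d ≤ᵇ x)) (incident w x)) ⟩
    ∑[ w < n ] sumBelow E (λ x → ind (not (d ≤ᵇ x)) * ind (incident w x))
      ≡⟨ sum-incident (λ x → ind (not (d ≤ᵇ x))) ⟩
    2 * sumBelow E (λ x → ind (not (d ≤ᵇ x)))                ≤⟨ *-monoʳ-≤ 2 (count-below≤ E d) ⟩
    2 * d                                                    ∎
    where open ≤-Reasoning

  sum-repeats : 1 ≤ d → ∑[ w < n ] repeats w ≤ E
  sum-repeats 1≤d = begin
    ∑[ w < n ] repeats w
      ≡⟨ ∑-comm {n} {E} (λ w a → ind (fits (toℕ a) ∧ incident w (toℕ a) ∧ incident w (toℕ a + d))) ⟩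
    ∑[ a < E ] ∑[ w < n ] ind (fits (toℕ a) ∧ incident w (toℕ a) ∧ incident w (toℕ a + d))
      ≤⟨ sum-mono-≤ (λ a → atMostOne (toℕ a) (FinP.toℕ<n a)) ⟩
    ∑[ a < E ] 1
      ≡⟨ trans (sum-const E 1) (*-identityʳ E) ⟩
    E ∎
    where
    open ≤-Reasoning
    atMostOne : ∀ a → a < E → ∑[ w < n ] ind (fits a ∧ incident w a ∧ incident w (a + d)) ≤ 1
    atMostOne a a<E = byFits (T? (fits a))
      where
      byFits : Dec (T (fits a)) → ∑[ w < n ] ind (fits a ∧ incident w a ∧ incident w (a + d)) ≤ 1
      byFits (no ¬fits) = ≤-trans (≤-reflexive (sum-zero n λ w → cong (λ b → ind (b ∧ incident w a ∧ incident w (a + d))) (¬T⇒≡false ¬fits))) z≤n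
      byFits (yes fits-a) = subst (_≤ 1) (sum-cong-≗ λ w → cong (λ b → ind (b ∧ incident w a ∧ incident w (a + d))) (sym (T⇒≡true fits-a)))
        (shared-incident≤1 a<E (<ᵇ⇒< (a + d) E fits-a) λ a≡a+d → <-irrefl (trans a≡a+d (+-comm a d)) (m<n+m a 1≤d))

  chain-begins≤degree : ∀ u → sumBelow E (λ a → ind ((d ≤ᵇ a) ∧ fits a ∧ incident u (a ∸ d))) ≤ sumBelow E (λ b → ind (incident u b))
  chain-begins≤degree u = begin
    sumBelow E (λ a → ind ((d ≤ᵇ a) ∧ fits a ∧ incident u (a ∸ d)))
      ≤⟨ sumBelow-mono-≤ E (λ a a<E → shifted a a<E (T? (d ≤ᵇ a))) ⟩
    sumBelow E (λ a → ind (d ≤ᵇ a) * ind (fits (a ∸ d) ∧ incident u (a ∸ d)))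
      ≡⟨ sumBelow-shift E d (λ b → ind (fits b ∧ incident u b)) unfit ⟩
    sumBelow E (λ b → ind (fits b ∧ incident u b))
      ≤⟨ sumBelow-mono-≤ E (λ b _ → ind-∧-≤ʳ (fits b) (incident u b)) ⟩
    sumBelow E (λ b → ind (incident u b)) ∎
    where
    open ≤-Reasoning
    unfit : ∀ b → E ≤ b + d → ind (fits b ∧ incident u b) ≡ 0
    unfit b E≤b+d = cong (λ c → ind (c ∧ incident u b)) (¬T⇒≡false λ fits-b → <⇒≱ (<ᵇ⇒< (b + d) E fits-b) E≤b+d)
    shifted : ∀ a → a < E → Dec (T (d ≤ᵇ a)) →
      ind ((d ≤ᵇ a) ∧ fits a ∧ incident u (a ∸ d)) ≤ ind (d ≤ᵇ a) * ind (fits (a ∸ d) ∧ incident u (a ∸ d))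
    shifted a a<E (no d≰a) rewrite ¬T⇒≡false d≰a = z≤n
    shifted a a<E (yes d≤a) rewrite T⇒≡true d≤a | m∸n+n≡m (≤ᵇ⇒≤ d a d≤a) | T⇒≡true (<⇒<ᵇ a<E) =
      ≤-trans (ind-∧-≤ʳ (fits a) (incident u (a ∸ d))) (≤-reflexive (sym (+-identityʳ _)))

  sum-chains : ∀ u → ∑[ w < n ] chains u w ≤ 2 * sumBelow E (λ b → ind (incident u b))
  sum-chains u = begin
    ∑[ w < n ] chains u w
      ≡⟨ sum-cong-≗ (λ w → sumBelow-cong E λ a _ → ind-∧³ (d ≤ᵇ a) (fits a) (incident u (a ∸ d)) (incident w (a + d))) ⟩
    ∑[ w < n ] sumBelow E (λ a → ind (begins a) * ind (incident w (a + d)))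
      ≡⟨ ∑-comm {n} {E} (λ w a → ind (begins (toℕ a)) * ind (incident w (toℕ a + d))) ⟩
    ∑[ a < E ] ∑[ w < n ] (ind (begins (toℕ a)) * ind (incident w (toℕ a + d)))
      ≡⟨ sum-cong-≗ {E} (λ a → sym (*-distribˡ-sum (ind (begins (toℕ a))) (λ w → ind (incident w (toℕ a + d))))) ⟩
    ∑[ a < E ] (ind (begins (toℕ a)) * ∑[ w < n ] ind (incident w (toℕ a + d)))
      ≤⟨ sum-mono-≤ {E} (λ a → atMostTwo (toℕ a) (T? (begins (toℕ a)))) ⟩
    ∑[ a < E ] (2 * ind (begins (toℕ a)))
      ≡⟨ sym (*-distribˡ-sum {E} 2 (λ a → ind (begins (toℕ a)))) ⟩
    2 * sumBelow E (λ a → ind (begins a))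
      ≤⟨ *-monoʳ-≤ 2 (chain-begins≤degree u) ⟩
    2 * sumBelow E (λ b → ind (incident u b)) ∎
    where
    open ≤-Reasoning
    begins : ℕ → Bool
    begins a = (d ≤ᵇ a) ∧ fits a ∧ incident u (a ∸ d)
    atMostTwo : ∀ a → Dec (T (begins a)) → ind (begins a) * ∑[ w < n ] ind (incident w (a + d)) ≤ 2 * ind (begins a)
    atMostTwo a (no ¬begins) rewrite ¬T⇒≡false ¬begins = z≤n
    atMostTwo a (yes begins-a) rewrite T⇒≡true begins-a =
      ≤-reflexive (trans (+-identityʳ _) (count-incident (<ᵇ⇒< (a + d) E fits-a)))
      where
      fits-a : T (fits a)
      fits-a = proj₁ (Equivalence.to (T-∧ {fits a}) (proj₂ (Equivalence.to (T-∧ {d ≤ᵇ a}) begins-a)))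

  shift-fits : ∀ (F : ℕ → Bool) → sumBelow E (λ a → ind (fits a ∧ F (a + d))) ≡ sumBelow E (λ x → ind (d ≤ᵇ x) * ind (F x))
  shift-fits F = sym (trans (sumBelow-cong E (λ x x<E → pointwise x x<E (T? (d ≤ᵇ x)))) (sumBelow-shift E d (λ a → ind (fits a ∧ F (a + d))) unfit))
    where
    unfit : ∀ a → E ≤ a + d → ind (fits a ∧ F (a + d)) ≡ 0
    unfit a E≤a+d = cong (λ c → ind (c ∧ F (a + d))) (¬T⇒≡false λ fits-a → <⇒≱ (<ᵇ⇒< (a + d) E fits-a) E≤a+d)
    pointwise : ∀ x → x < E → Dec (T (d ≤ᵇ x)) → ind (d ≤ᵇ x) * ind (F x) ≡ ind (d ≤ᵇ x) * ind (fits (x ∸ d) ∧ F (x ∸ d + d))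
    pointwise x x<E (no d≰x) rewrite ¬T⇒≡false d≰x = refl
    pointwise x x<E (yes d≤x) rewrite T⇒≡true d≤x | m∸n+n≡m (≤ᵇ⇒≤ d x d≤x) | T⇒≡true (<⇒<ᵇ x<E) = refl

  first-vertex : Fin n → 1 ≤ d → ∃[ u ] (n * (late u + repeats u) ≤ 2 * d + E)
  first-vertex w 1≤d with ∃-≤-average (λ _ → true) (λ u → late u + repeats u) w _
  ... | u , _ , u-bound = u , (begin
    n * (late u + repeats u)                  ≡⟨ cong (_* (late u + repeats u)) (sym (trans (sum-const n 1) (*-identityʳ n))) ⟩
    (∑[ j < n ] ind true) * (late u + repeats u) ≤⟨ u-bound ⟩
    ∑[ j < n ] (ind true * (late j + repeats j)) ≡⟨ sum-cong-≗ (λ j → *-identityˡ (late j + repeats j)) ⟩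
    ∑[ j < n ] (late j + repeats j)           ≡⟨ ∑-distrib-+ late repeats ⟩
    ∑[ j < n ] late j + ∑[ j < n ] repeats j  ≤⟨ +-mono-≤ sum-late (sum-repeats 1≤d) ⟩
    2 * d + E                                 ∎)
    where open ≤-Reasoning

  second-vertex : ∀ u (w : Fin n) → ¬ w ≡ u → 1 ≤ d →
    ∃[ v ] (¬ u ≡ v × (n ∸ 1) * (early v + repeats v + 2 * chains u v) ≤ 2 * d + E + 4 * (n ∸ 1))
  second-vertex u w w≢u 1≤d
    with ∃-≤-average (λ j → not (does (j FinP.≟ u))) (λ j → early j + repeats j + 2 * chains u j) w (⇒does-not (w FinP.≟ u) w≢u)
  ... | v , v≢u , v-bound = v , (λ u≡v → does⇒-not (v FinP.≟ u) v≢u (sym u≡v)) , (begin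
    (n ∸ 1) * g v
      ≡⟨ cong (_* g v) (count-others-∸ u) ⟨
    (∑[ j < n ] ind (not (does (j FinP.≟ u)))) * g v
      ≤⟨ v-bound ⟩
    ∑[ j < n ] (ind (not (does (j FinP.≟ u))) * g j)
      ≤⟨ sum-mono-≤ (λ j → ind-*-≤ (not (does (j FinP.≟ u))) (g j)) ⟩
    ∑[ j < n ] (early j + repeats j + 2 * chains u j)
      ≡⟨ ∑-distrib-+ (λ j → early j + repeats j) (λ j → 2 * chains u j) ⟩
    ∑[ j < n ] (early j + repeats j) + ∑[ j < n ] (2 * chains u j)
      ≡⟨ cong₂ _+_ (∑-distrib-+ early repeats) (sym (*-distribˡ-sum 2 (chains u))) ⟩
    ∑[ j < n ] early j + ∑[ j < n ] repeats j + 2 * ∑[ j < n ] chains u j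
      ≤⟨ +-mono-≤ (+-mono-≤ sum-early (sum-repeats 1≤d)) (*-monoʳ-≤ 2 (sum-chains u)) ⟩
    2 * d + E + 2 * (2 * sumBelow E (λ b → ind (incident u b)))
      ≡⟨ cong (λ z → 2 * d + E + z) (trans (sym (*-assoc 2 2 (sumBelow E (λ b → ind (incident u b))))) (cong (4 *_) degree-u)) ⟩
    2 * d + E + 4 * (n ∸ 1) ∎)
    where
    open ≤-Reasoning
    g : Fin n → ℕ
    g w = early w + repeats w + 2 * chains u w
    degree-u : sumBelow E (λ b → ind (incident u b)) ≡ n ∸ 1
    degree-u = trans (sym (m+n∸n≡m (sumBelow E (λ b → ind (incident u b))) 1)) (cong (_∸ 1) (degree u))

module GreedySwap {n : ℕ} (t : Labeling n) (d : ℕ) (u v : Fin n) where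
  open Positions t
  open DisplacementCounts t d

  improving : ℕ → Bool
  improving a = fits a ∧ Improves (incident u a) (incident v a) (incident u (a + d)) (incident v (a + d))

  -- a is paired with a + d when that exchange improves, unless a − d was improving: this keeps the
  -- pairs disjoint, and an improving a that is skipped sits in a chain counted by chains u v.
  lower : ℕ → Bool
  lower a = improving a ∧ not ((d ≤ᵇ a) ∧ improving (a ∸ d))

  upper : ℕ → Bool
  upper x = (d ≤ᵇ x) ∧ lower (x ∸ d)

  lower⇒fits : ∀ a → lower a ≡ true → a + d < E
  lower⇒fits a la = <ᵇ⇒< (a + d) E (Equivalence.from T-≡ (∧-conicalˡ (fits a) _ (∧-conicalˡ (improving a) _ la)))

  lower⇒¬upper : ∀ x → lower x ≡ true → upper x ≡ false
  lower⇒¬upper x lx with upper x in ux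
  ... | false = refl
  ... | true = contradiction (trans (sym (cong₂ (λ p q → not (p ∧ q)) d≤x previous)) (∧-conicalʳ (improving x) _ lx)) λ ()
    where
    d≤x : (d ≤ᵇ x) ≡ true
    d≤x = ∧-conicalˡ (d ≤ᵇ x) (lower (x ∸ d)) ux
    previous : improving (x ∸ d) ≡ true
    previous = ∧-conicalˡ (improving (x ∸ d)) _ (∧-conicalʳ (d ≤ᵇ x) (lower (x ∸ d)) ux)

  upper⇒d≤ : ∀ x → upper x ≡ true → d ≤ x
  upper⇒d≤ x ux = ≤ᵇ⇒≤ d x (Equivalence.from T-≡ (∧-conicalˡ (d ≤ᵇ x) (lower (x ∸ d)) ux))

  upper⇒lower : ∀ x → upper x ≡ true → lower (x ∸ d) ≡ true
  upper⇒lower x ux = ∧-conicalʳ (d ≤ᵇ x) (lower (x ∸ d)) ux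

  lower⇒¬lower : ∀ a → lower a ≡ true → lower (a + d) ≡ false
  lower⇒¬lower a la = begin
    improving (a + d) ∧ not ((d ≤ᵇ a + d) ∧ improving (a + d ∸ d))
      ≡⟨ cong₂ (λ p q → improving (a + d) ∧ not (p ∧ improving q)) (T⇒≡true (≤⇒≤ᵇ (m≤n+m d a))) (m+n∸n≡m a d) ⟩
    improving (a + d) ∧ not (improving a)
      ≡⟨ cong (λ p → improving (a + d) ∧ not p) (∧-conicalˡ (improving a) _ la) ⟩
    improving (a + d) ∧ false
      ≡⟨ ∧-zeroʳ _ ⟩
    false ∎
    where open ≡-Reasoning

  lower⇒upper : ∀ a → lower a ≡ true → upper (a + d) ≡ true
  lower⇒upper a la = trans (cong₂ (λ p q → p ∧ lower q) (T⇒≡true (≤⇒≤ᵇ (m≤n+m d a))) (m+n∸n≡m a d)) la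

  move : Bool → Bool → ℕ → ℕ
  move true _ x = x + d
  move false true x = x ∸ d
  move false false x = x

  partner : ℕ → ℕ
  partner x = move (lower x) (upper x) x

  partner-shift : ∀ x → partner x + d * ind (upper x) ≡ x + d * ind (lower x)
  partner-shift x with lower x in lx | upper x in ux
  ... | true | true = contradiction (trans (sym (lower⇒¬upper x lx)) ux) λ ()
  ... | true | false = trans (cong (x + d +_) (*-zeroʳ d)) (trans (+-identityʳ _) (cong (x +_) (sym (*-identityʳ d))))
  ... | false | true = trans (cong (x ∸ d +_) (*-identityʳ d)) (trans (m∸n+n≡m (upper⇒d≤ x ux)) (sym (trans (cong (x +_) (*-zeroʳ d)) (+-identityʳ x))))
  ... | false | false = refl

  partner<E : ∀ x → x < E → partner x < E
  partner<E x x<E with lower x in lx | upper x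
  ... | true | _ = lower⇒fits x lx
  ... | false | true = ≤-<-trans (m∸n≤m x d) x<E
  ... | false | false = x<E

  partner-involutive : ∀ x → partner (partner x) ≡ x
  partner-involutive x with lower x in lx | upper x in ux
  ... | true | _ rewrite lower⇒¬lower x lx | lower⇒upper x lx = m+n∸n≡m x d
  ... | false | true rewrite upper⇒lower x ux = m∸n+n≡m (upper⇒d≤ x ux)
  ... | false | false rewrite lx | ux = refl

  partner-moves≤d : ∀ x → ∣ x - partner x ∣ ≤ d
  partner-moves≤d x with lower x | upper x in ux
  ... | true | _ = ≤-reflexive (∣m-m+n∣≡n x d)
  ... | false | true = m≤n+o⇒n≤m+o⇒∣m-n∣≤o x (x ∸ d) (≤-reflexive (sym (m∸n+n≡m (upper⇒d≤ x ux)))) (≤-trans (m∸n≤m x d) (m≤m+n x d))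
  ... | false | false = subst (_≤ d) (sym (∣n-n∣≡0 x)) z≤n

  open Relabel partner partner<E partner-involutive using (relabel; relabel-isPSwap; vertexSum-relabel)

  swapped : Labeling n
  swapped = relabel

  swapped-isPSwap : IsPSwapOf d t swapped
  swapped-isPSwap = relabel-isPSwap partner-moves≤d

  raised lowered : Fin n → ℕ
  raised w = sumBelow E (λ a → ind (lower a ∧ incident w a))
  lowered w = sumBelow E (λ a → ind (lower a ∧ incident w (a + d)))

  lowered-as-upper : ∀ w → sumBelow E (λ x → ind (incident w x) * ind (upper x)) ≡ lowered w
  lowered-as-upper w = trans (sumBelow-cong E λ x _ → pointwise x (T? (d ≤ᵇ x))) (sumBelow-shift E d (λ a → ind (lower a ∧ incident w (a + d))) unfit)
    where
    unfit : ∀ a → E ≤ a + d → ind (lower a ∧ incident w (a + d)) ≡ 0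
    unfit a E≤a+d with lower a in la
    ... | true = contradiction E≤a+d (<⇒≱ (lower⇒fits a la))
    ... | false = refl
    pointwise : ∀ x → Dec (T (d ≤ᵇ x)) → ind (incident w x) * ind (upper x) ≡ ind (d ≤ᵇ x) * ind (lower (x ∸ d) ∧ incident w (x ∸ d + d))
    pointwise x (no d≰x) rewrite ¬T⇒≡false d≰x = *-zeroʳ (ind (incident w x))
    pointwise x (yes d≤x) rewrite T⇒≡true d≤x = begin
      ind (incident w x) * ind (lower (x ∸ d))         ≡⟨ sym (ind-∧ (incident w x) (lower (x ∸ d))) ⟩
      ind (incident w x ∧ lower (x ∸ d))               ≡⟨ cong ind (∧-comm (incident w x) (lower (x ∸ d))) ⟩
      ind (lower (x ∸ d) ∧ incident w x)               ≡⟨ cong (λ y → ind (lower (x ∸ d) ∧ incident w y)) (sym (m∸n+n≡m (≤ᵇ⇒≤ d x d≤x))) ⟩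
      ind (lower (x ∸ d) ∧ incident w (x ∸ d + d))     ≡⟨ sym (+-identityʳ _) ⟩
      ind (lower (x ∸ d) ∧ incident w (x ∸ d + d)) + 0 ∎
      where open ≡-Reasoning

  vertexSum-swapped : ∀ w → s swapped w + d * lowered w ≡ s t w + d * raised w
  vertexSum-swapped w = begin
    s swapped w + d * lowered w
      ≡⟨ cong₂ (λ p q → p + d * q) (vertexSum-relabel w) (sym (lowered-as-upper w)) ⟩
    sumBelow E moved + d * sumBelow E atUpper
      ≡⟨ cong (sumBelow E moved +_) (sumBelow-* E d atUpper) ⟩
    sumBelow E moved + sumBelow E (λ x → d * atUpper x)
      ≡⟨ sym (sumBelow-distrib E moved (λ x → d * atUpper x)) ⟩
    sumBelow E (λ x → moved x + d * atUpper x)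
      ≡⟨ sumBelow-cong E (λ x _ → pointwise x) ⟩
    sumBelow E (λ x → unmoved x + d * ind (lower x ∧ incident w x))
      ≡⟨ sumBelow-distrib E unmoved (λ x → d * ind (lower x ∧ incident w x)) ⟩
    sumBelow E unmoved + sumBelow E (λ x → d * ind (lower x ∧ incident w x))
      ≡⟨ cong₂ _+_ (sym (vertexSum-positions w)) (sym (sumBelow-* E d (λ x → ind (lower x ∧ incident w x)))) ⟩
    s t w + d * raised w ∎
    where
    open ≡-Reasoning
    moved atUpper unmoved : ℕ → ℕ
    moved x = ind (incident w x) * suc (partner x)
    atUpper x = ind (incident w x) * ind (upper x)
    unmoved x = ind (incident w x) * suc x
    pointwise : ∀ x → ind (incident w x) * suc (partner x) + d * (ind (incident w x) * ind (upper x))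
                    ≡ ind (incident w x) * suc x + d * ind (lower x ∧ incident w x)
    pointwise x with incident w x
    ... | false = cong (d *_) (cong ind (sym (∧-zeroʳ (lower x))))
    ... | true = begin
      suc (partner x) + 0 + d * (ind (upper x) + 0)    ≡⟨ cong₂ (λ p q → p + d * q) (+-identityʳ _) (+-identityʳ _) ⟩
      suc (partner x + d * ind (upper x))              ≡⟨ cong suc (partner-shift x) ⟩
      suc (x + d * ind (lower x))                      ≡⟨ cong₂ (λ p q → p + d * ind q) (sym (+-identityʳ _)) (sym (∧-identityʳ (lower x))) ⟩
      suc x + 0 + d * ind (lower x ∧ true)             ∎

  gainU gainV : ℕ → Bool
  gainU a = GainU (fits a) (incident u a) (incident v a) (incident u (a + d))
  gainV a = GainV (fits a) (incident v a) (incident u (a + d)) (incident v (a + d))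

  realized : ℕ
  realized = sumBelow E (λ a → ind (lower a ∧ gainU a) + ind (lower a ∧ gainV a))

  realized-gain : realized + lowered u + raised v ≤ raised u + lowered v
  realized-gain = begin
    realized + lowered u + raised v
      ≡⟨ cong (_+ raised v) (sym (sumBelow-distrib E realizedAt (λ a → ind (lower a ∧ incident u (a + d))))) ⟩
    sumBelow E (λ a → realizedAt a + ind (lower a ∧ incident u (a + d))) + raised v
      ≡⟨ sym (sumBelow-distrib E (λ a → realizedAt a + ind (lower a ∧ incident u (a + d))) (λ a → ind (lower a ∧ incident v a))) ⟩
    sumBelow E (λ a → realizedAt a + ind (lower a ∧ incident u (a + d)) + ind (lower a ∧ incident v a))
      ≤⟨ sumBelow-mono-≤ E (λ a _ → gain-covers (fits a) (incident u a) (incident v a) (incident u (a + d)) (incident v (a + d))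
                                                (not ((d ≤ᵇ a) ∧ improving (a ∸ d)))) ⟩
    sumBelow E (λ a → ind (lower a ∧ incident u a) + ind (lower a ∧ incident v (a + d)))
      ≡⟨ sumBelow-distrib E (λ a → ind (lower a ∧ incident u a)) (λ a → ind (lower a ∧ incident v (a + d))) ⟩
    raised u + lowered v ∎
    where
    open ≤-Reasoning
    realizedAt : ℕ → ℕ
    realizedAt a = ind (lower a ∧ gainU a) + ind (lower a ∧ gainV a)

  previous-improving : ∀ a → (d ≤ᵇ a) ∧ improving (a ∸ d)
    ≡ (d ≤ᵇ a) ∧ (fits (a ∸ d) ∧ Improves (incident u (a ∸ d)) (incident v (a ∸ d)) (incident u a) (incident v a))
  previous-improving a = byCases (T? (d ≤ᵇ a))
    where
    byCases : Dec (T (d ≤ᵇ a)) → (d ≤ᵇ a) ∧ improving (a ∸ d)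
      ≡ (d ≤ᵇ a) ∧ (fits (a ∸ d) ∧ Improves (incident u (a ∸ d)) (incident v (a ∸ d)) (incident u a) (incident v a))
    byCases (no d≰a) rewrite ¬T⇒≡false d≰a = refl
    byCases (yes d≤a) rewrite T⇒≡true d≤a =
      cong (λ y → fits (a ∸ d) ∧ Improves (incident u (a ∸ d)) (incident v (a ∸ d)) (incident u y) (incident v y)) (m∸n+n≡m (≤ᵇ⇒≤ d a d≤a))

  gains≤realized : sumBelow E (λ a → ind (gainU a)) + sumBelow E (λ a → ind (gainV a)) ≤ realized + 2 * chains u v
  gains≤realized = begin
    sumBelow E (λ a → ind (gainU a)) + sumBelow E (λ a → ind (gainV a))
      ≡⟨ sym (sumBelow-distrib E (λ a → ind (gainU a)) (λ a → ind (gainV a))) ⟩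
    sumBelow E (λ a → ind (gainU a) + ind (gainV a))
      ≤⟨ sumBelow-mono-≤ E (λ a _ → pointwise a) ⟩
    sumBelow E (λ a → realizedAt a + 2 * chainAt a)
      ≡⟨ sumBelow-distrib E realizedAt (λ a → 2 * chainAt a) ⟩
    realized + sumBelow E (λ a → 2 * chainAt a)
      ≡⟨ cong (realized +_) (sym (sumBelow-* E 2 chainAt)) ⟩
    realized + 2 * chains u v ∎
    where
    open ≤-Reasoning
    realizedAt chainAt : ℕ → ℕ
    realizedAt a = ind (lower a ∧ gainU a) + ind (lower a ∧ gainV a)
    chainAt a = ind ((d ≤ᵇ a) ∧ fits a ∧ incident u (a ∸ d) ∧ incident v (a + d))
    pointwise : ∀ a → ind (gainU a) + ind (gainV a) ≤ realizedAt a + 2 * chainAt a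
    pointwise a = subst (λ P → ind (gainU a) + ind (gainV a)
                                 ≤ ind ((improving a ∧ not P) ∧ gainU a) + ind ((improving a ∧ not P) ∧ gainV a) + 2 * chainAt a)
      (sym (previous-improving a))
      (gains-skipped (fits a) (incident u a) (incident v a) (incident u (a + d)) (incident v (a + d))
                     (d ≤ᵇ a) (fits (a ∸ d)) (incident u (a ∸ d)) (incident v (a ∸ d)))

  degree-u : n ≤ sumBelow E (λ a → ind (gainU a)) + late u + repeats u + sumBelow E (λ a → ind (incident u a ∧ incident v a)) + 1
  degree-u = begin
    n
      ≡⟨ sym (degree u) ⟩
    sumBelow E (λ a → ind (incident u a)) + 1
      ≤⟨ +-monoˡ-≤ 1 (sumBelow-mono-≤ E λ a _ → degree-splitU (fits a) (incident u a) (incident v a) (incident u (a + d))) ⟩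
    sumBelow E (λ a → ind (gainU a) + ind (incident u a ∧ not (fits a)) + ind (fits a ∧ incident u a ∧ incident u (a + d))
                      + ind (incident u a ∧ incident v a)) + 1
      ≡⟨ cong (_+ 1) (sumBelow-distrib⁴ E (λ a → ind (gainU a)) (λ a → ind (incident u a ∧ not (fits a)))
                       (λ a → ind (fits a ∧ incident u a ∧ incident u (a + d))) (λ a → ind (incident u a ∧ incident v a))) ⟩
    sumBelow E (λ a → ind (gainU a)) + late u + repeats u + sumBelow E (λ a → ind (incident u a ∧ incident v a)) + 1 ∎
    where open ≤-Reasoning

  degree-v : ¬ u ≡ v → n ≤ sumBelow E (λ a → ind (gainV a)) + 1 + repeats v + early v + 1
  degree-v u≢v = begin
    n
      ≡⟨ sym (degree v) ⟩
    sumBelow E (λ x → ind (incident v x)) + 1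
      ≤⟨ +-monoˡ-≤ 1 (sumBelow-mono-≤ E λ x _ → ind-split (d ≤ᵇ x) (incident v x)) ⟩
    sumBelow E (λ x → ind (d ≤ᵇ x) * ind (incident v x) + ind (not (d ≤ᵇ x) ∧ incident v x)) + 1
      ≡⟨ cong (_+ 1) (trans (sumBelow-distrib E (λ x → ind (d ≤ᵇ x) * ind (incident v x)) (λ x → ind (not (d ≤ᵇ x) ∧ incident v x)))
                            (cong (_+ early v) (sym (shift-fits (incident v))))) ⟩
    sumBelow E (λ a → ind (fits a ∧ incident v (a + d))) + early v + 1
      ≤⟨ +-monoˡ-≤ 1 (+-monoˡ-≤ (early v) (sumBelow-mono-≤ E λ a _ → degree-splitV (fits a) (incident v a) (incident u (a + d)) (incident v (a + d)))) ⟩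
    sumBelow E (λ a → ind (gainV a) + ind (fits a ∧ incident u (a + d) ∧ incident v (a + d)) + ind (fits a ∧ incident v a ∧ incident v (a + d)))
      + early v + 1
      ≡⟨ cong (λ z → z + early v + 1) (sumBelow-distrib³ E (λ a → ind (gainV a)) (λ a → ind (fits a ∧ incident u (a + d) ∧ incident v (a + d)))
                                          (λ a → ind (fits a ∧ incident v a ∧ incident v (a + d)))) ⟩
    sumBelow E (λ a → ind (gainV a)) + sumBelow E (λ a → ind (fits a ∧ incident u (a + d) ∧ incident v (a + d))) + repeats v + early v + 1
      ≤⟨ +-monoˡ-≤ 1 (+-monoˡ-≤ (early v) (+-monoˡ-≤ (repeats v) (+-monoʳ-≤ (sumBelow E (λ a → ind (gainV a))) sharedLater≤1))) ⟩
    sumBelow E (λ a → ind (gainV a)) + 1 + repeats v + early v + 1 ∎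
    where
    open ≤-Reasoning
    sharedLater≤1 : sumBelow E (λ a → ind (fits a ∧ incident u (a + d) ∧ incident v (a + d))) ≤ 1
    sharedLater≤1 = begin
      sumBelow E (λ a → ind (fits a ∧ incident u (a + d) ∧ incident v (a + d)))
        ≡⟨ shift-fits (λ x → incident u x ∧ incident v x) ⟩
      sumBelow E (λ x → ind (d ≤ᵇ x) * ind (incident u x ∧ incident v x))
        ≤⟨ sumBelow-mono-≤ E (λ x _ → ind-*-≤ (d ≤ᵇ x) (ind (incident u x ∧ incident v x))) ⟩
      sumBelow E (λ x → ind (incident u x ∧ incident v x))
        ≤⟨ common-incident≤1 u≢v ⟩
      1 ∎

  excess : ℕ
  excess = (late u + repeats u) + (early v + repeats v + 2 * chains u v) + 4

  twice-degree≤ : ¬ u ≡ v → 2 * n ≤ realized + excess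
  twice-degree≤ u≢v = begin
    2 * n
      ≡⟨ cong (n +_) (+-identityʳ n) ⟩
    n + n
      ≤⟨ +-mono-≤ (≤-trans degree-u (+-monoˡ-≤ 1 (+-monoʳ-≤ (gU + late u + repeats u) (common-incident≤1 u≢v)))) (degree-v u≢v) ⟩
    (gU + late u + repeats u + 1 + 1) + (gV + 1 + repeats v + early v + 1)
      ≡⟨ rearrange gU gV (late u) (repeats u) (early v) (repeats v) ⟩
    (gU + gV) + (late u + repeats u + (early v + repeats v) + 4)
      ≤⟨ +-monoˡ-≤ _ gains≤realized ⟩
    (realized + 2 * chains u v) + (late u + repeats u + (early v + repeats v) + 4)
      ≡⟨ regroup realized (chains u v) (late u + repeats u) (early v + repeats v) ⟩
    realized + excess ∎
    where
    open ≤-Reasoning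
    gU gV : ℕ
    gU = sumBelow E (λ a → ind (gainU a))
    gV = sumBelow E (λ a → ind (gainV a))
    rearrange : ∀ a b c e f g → (a + c + e + 1 + 1) + (b + 1 + g + f + 1) ≡ (a + b) + (c + e + (f + g) + 4)
    rearrange = solve-∀
    regroup : ∀ r h x y → (r + 2 * h) + (x + y + 4) ≡ r + (x + (y + 2 * h) + 4)
    regroup = solve-∀

  swap-gain : ¬ u ≡ v → s t u + s swapped v + d * (2 * n) ≤ s swapped u + s t v + d * excess
  swap-gain u≢v = begin
    s t u + s swapped v + d * (2 * n)                ≤⟨ +-monoʳ-≤ (s t u + s swapped v) (*-monoʳ-≤ d (twice-degree≤ u≢v)) ⟩
    s t u + s swapped v + d * (realized + excess)    ≡⟨ cong (s t u + s swapped v +_) (*-distribˡ-+ d realized excess) ⟩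
    s t u + s swapped v + (d * realized + d * excess) ≡⟨ sym (+-assoc (s t u + s swapped v) _ _) ⟩
    s t u + s swapped v + d * realized + d * excess  ≤⟨ +-monoˡ-≤ (d * excess) transfer ⟩
    s swapped u + s t v + d * excess                 ∎
    where
    open ≤-Reasoning
    transfer : s t u + s swapped v + d * realized ≤ s swapped u + s t v
    transfer = gain-transfer {s t u} {s t v} {s swapped u} {s swapped v} {d} {lowered u} {raised u} {lowered v} {raised v}
                             (vertexSum-swapped u) (vertexSum-swapped v) realized-gain

another-vertex : ∀ {n} → 2 ≤ n → (u : Fin n) → ∃[ w ] ¬ w ≡ u
another-vertex (s≤s (s≤s _)) F.zero = F.suc F.zero , λ ()
another-vertex (s≤s (s≤s _)) (F.suc u) = F.zero , λ ()

lower-bound : ∀ {n} (t : Labeling n) {d α r} → 2 ≤ n → 1 ≤ d → 2 * d ≤ n → AlmostSupermagic α t →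
  (∀ t′ → IsPSwapOf d t t′ → ∀ u v → ¬ u ≡ v → ∣ s t′ u - s t′ v ∣ ≤ r) →
  2 * (d * n) ≤ 2 * r + 2 * α + 21 * d
lower-bound {n} t {d} {α} {r} 2≤n 1≤d 2d≤n magic spread with DisplacementCounts.first-vertex t d (fromℕ< (≤-trans (s≤s z≤n) 2≤n)) 1≤d
... | u , u-bound with another-vertex 2≤n u
... | w , w≢u with DisplacementCounts.second-vertex t d u w w≢u 1≤d
... | v , u≢v , v-bound =
  spread≥ {s t u} {s t v} {s swapped u} {s swapped v} {d} {n} {excess} {α} {r}
          (swap-gain u≢v) (∣m-n∣≤o⇒m≤n+o (s t v) (s t u) (magic v u))
          (∣m-n∣≤o⇒m≤n+o (s swapped u) (s swapped v) (spread swapped swapped-isPSwap u v u≢v))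
          (twice-excess≤ {n} {late u + repeats u} {early v + repeats v + 2 * chains u v}
            (twice-first-choice≤ {n} {d} {ε n} (≤-trans (s≤s z≤n) 2≤n) (two-ε n) 2d≤n u-bound)
            (twice-second-choice≤ {n} {d} {ε n} 2≤n (two-ε n) 2d≤n v-bound))
  where
  open DisplacementCounts t d
  open GreedySwap t d u v

R-lower-bound : ∀ {n} (t : Labeling n) {d α c k r} → AlmostSupermagic α t → (2 ≤ n → IsR n d t r) →
  α ≤ c * n → 2 * suc k * c ≤ d → 1 ≤ d → 2 * d ≤ n → 21 * suc k < n → k * (d * n) < suc k * r
R-lower-bound {n} t magic isR α≤ 2kc≤d 1≤d 2d≤n 21k<n =
  lower-asymptotic (lower-bound t 2≤n 1≤d 2d≤n magic (proj₂ (isR 2≤n))) 1≤d α≤ 2kc≤d 21k<n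
  where
  2≤n : 2 ≤ n
  2≤n = ≤-trans (s≤s (s≤s z≤n)) 21k<n

R-upper-bound : ∀ {n} (t : Labeling n) {p α c k r} → AlmostSupermagic α t → IsR n p t r →
  α ≤ c * n → suc (k * c) ≤ p → 1 ≤ n → k * r < (2 * k + 1) * (p * n)
R-upper-bound {n} t {p} {α} {c} {k} magic ((t′ , swap , u , v , _ , spread≡r) , _) α≤ kc<p 1≤n =
  upper-asymptotic {k} {n} {p} {α} {c} (subst (_≤ α + 2 * (n * p)) spread≡r (pSwap-spread≤ magic swap u v)) 1≤n α≤ kc<p

eventually-∧ : ∀ {P Q : ℕ → Set} → Eventually P → Eventually Q → Eventually (λ n → P n × Q n)
eventually-∧ (M , P≥) (N , Q≥) = M ⊔ N , λ n M⊔N≤n → P≥ n (≤-trans (m≤m⊔n M N) M⊔N≤n) , Q≥ n (≤-trans (m≤n⊔m M N) M⊔N≤n)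

eventually-≥ : ∀ N → Eventually (N ≤_)
eventually-≥ N = N , λ n N≤n → N≤n

eventually-mono : ∀ {P Q : ℕ → Set} → (∀ {n} → P n → Q n) → Eventually P → Eventually Q
eventually-mono P⇒Q (N , P≥) = N , λ n N≤n → P⇒Q (P≥ n N≤n)

theorem4p4 : (α p : ℕ → ℕ) → IsBigO-n α → Admissible p →
    (t : (n : ℕ) → Labeling n) → (∀ n → AlmostSupermagic (α n) (t n)) →
    (R : ℕ → ℕ) → (∀ n → 2 ≤ n → IsR n (p n) (t n) (R n)) →
    ∀ k → 1 ≤ k →
      Eventually (λ n → (k ∸ 1) * (p n * n) < k * R n)
      × Eventually (λ n → k * R n < (2 * k + 1) * (p n * n))
theorem4p4 α p (c , α≤cn) (p≪n , p→∞) t magic R isR (suc k) _ =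
    eventually-mono (λ {n} (α≤ , 2kc≤p , 1≤p , 2p≤n , 21k<n) → R-lower-bound (t n) (magic n) (isR n) α≤ 2kc≤p 1≤p 2p≤n 21k<n)
      (eventually-∧ α≤cn (eventually-∧ (p→∞ (2 * suc k * c)) (eventually-∧ (p→∞ 1)
        (eventually-∧ (p≪n 2 (s≤s z≤n)) (eventually-≥ (suc (21 * suc k)))))))
  , eventually-mono (λ {n} (α≤ , kc<p , 2≤n) → R-upper-bound (t n) {c = c} {k = suc k} (magic n) (isR n 2≤n) α≤ kc<p (≤-trans (s≤s z≤n) 2≤n))
      (eventually-∧ α≤cn (eventually-∧ (p→∞ (suc (suc k * c))) (eventually-≥ 2)))
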